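{- Let $d\geqslant 2$ be a square-free integer with $d\equiv 1\pmod 3$, let $K=\mathbb{Q}(\sqrt{ -d})$, and let $S$ be the set of primes of $K$ above $3$. Then the only solutions $(\alpha,\gamma)\in\mathcal{O}_S^\times\times\mathcal{O}_S$ of $\alpha+1=\gamma^3$ are $(\alpha,\gamma)=(-1,0)$ and $(\alpha,\gamma)=(-9,-2)$.
   Context: $\mathcal{O}_S$ is the ring of $S$-integers of $K$ (elements $x\in K$ with $v_{\mathfrak P}(x)\ge0$ for every prime $\mathfrak P\notin S$) and $\mathcal{O}_S^\times$ is its unit group. -}

module Defs where

open import Data.Nat as ℕ using (ℕ; suc)
open import Data.Nat.Divisibility using (_∣_)
open import Data.Integer as ℤ using (ℤ; +_)
open import Data.Rational as ℚ using (ℚ; 0ℚ; 1ℚ)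
open import Data.List using (List; []; _∷_)
open import Data.Product using (Σ; ∃; _×_; _,_)
open import Relation.Binary.PropositionalEquality using (_≡_)

SquareFree : ℕ → Set
SquareFree d = ∀ (n : ℕ) → n ℕ.* n ∣ d → n ≡ 1

record K : Set where
  constructor _+√-d·_
  field
    re : ℚ
    im : ℚ
open K public

ιℚ : ℚ → K
ιℚ q = q +√-d· 0ℚ

ιℤ : ℤ → K
ιℤ z = ιℚ (z ℚ./ 1)

0K 1K : K
0K = ιℚ 0ℚ
1K = ιℚ 1ℚ

addK : K → K → K
addK (a +√-d· b) (c +√-d· e) = (a ℚ.+ c) +√-d· (b ℚ.+ e)

mulK : (d : ℕ) → K → K → K
mulK d (a +√-d· b) (c +√-d· e) =
  ((a ℚ.* c) ℚ.- (((+ d) ℚ./ 1) ℚ.* (b ℚ.* e))) +√-d· ((a ℚ.* e) ℚ.+ (b ℚ.* c))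

powK : (d : ℕ) → K → ℕ → K
powK d x 0 = 1K
powK d x (suc n) = mulK d x (powK d x n)

-- Value at x of the monic polynomial  X^n + c_{n-1} X^{n-1} + ... + c_0
-- whose lower coefficients are the list  c_0 ∷ c_1 ∷ ... ∷ c_{n-1}.
evalMonic : (d : ℕ) → List ℤ → K → K
evalMonic d [] x = 1K
evalMonic d (c ∷ cs) x = addK (ιℤ c) (mulK d x (evalMonic d cs x))

IsIntegral : (d : ℕ) → K → Set
IsIntegral d x = Σ (List ℤ) λ cs → evalMonic d cs x ≡ 0K

-- x ∈ 𝒪_S for S = primes above 3 : 3^k x ∈ 𝒪_K for some k  (𝒪_S = 𝒪_K[1/3]).
InOS : (d : ℕ) → K → Set
InOS d x = Σ ℕ λ k → IsIntegral d (mulK d (ιℤ (+ (3 ℕ.^ k))) x)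

IsSUnit : (d : ℕ) → K → Set
IsSUnit d x = InOS d x × Σ K λ y → InOS d y × mulK d x y ≡ 1K

-- An S-unit α = a + b√-d is rational. Some 3^k α is an algebraic integer, so its trace t and norm n are
-- integers: an integral element has p-integral trace and norm at every prime p. As α is a unit, n divides
-- a power of 3, and 4n − t² = d (2·3^k b)², so square-freeness makes B = 2·3^k b an integer with
-- t² + dB² = 4·3^f. Since d ≡ 1 (mod 3) and 4 ∤ d, descent modulo 3 forces B = 0, so α = ±3^e.
-- The imaginary part of α + 1 = γ³ is γ₁ (3γ₀² − dγ₁²) = 0, and 3γ₀² = dγ₁² has no solution with γ₁ ≠ 0:
-- the 3-adic valuations of the two sides have different parity. So γ = G / 3^l and ±3^e + 1 = γ³.
-- Comparing 3-adic valuations reduces this to a cube being 3^j + 1, 3^j − 1, or next to another cube;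
-- the only possibility is 2³ + 1 = 3², which gives (α, γ) = (−9, −2), besides (−1, 0).

module Submission where

open import Data.Nat.Primality using (Prime)
open import Defs
open import Data.Nat using (ℕ; _≤_; _%_)
open import Data.Integer using (-[1+_])
open import Data.Product using (_×_)
open import Data.Sum using (_⊎_)
open import Relation.Binary.PropositionalEquality using (_≡_)
open import Function.Bundles using (_⇔_; mk⇔)


module Rationals where
  open import Data.Nat.Base as ℕ using (ℕ; zero; suc)
  import Data.Nat.Properties as ℕ
  import Data.Nat.Coprimality as Coprimality
  open import Data.Integer.Base as ℤ using (ℤ; +_; -[1+_])
  import Data.Integer.Properties as ℤ
  open import Data.Rational.Base as ℚ using (ℚ; mkℚ; 0ℚ; ↥_; ↧_)
  import Data.Rational.Properties as ℚ
  open import Data.Rational.Unnormalised.Base as ℚᵘ using (*≡*)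
  import Data.Rational.Unnormalised.Properties as ℚᵘ
  open import Data.Product.Base using (Σ)
  open import Relation.Binary.PropositionalEquality
  open import Data.Rational.Solver using (module +-*-Solver)
  open +-*-Solver

  ι : ℤ → ℚ
  ι z = z ℚ./ 1

  IsInteger : ℚ → Set
  IsInteger q = Σ ℤ λ z → q ≡ ι z

  -- ι z is computed by normalising z / 1; ι₀ z is the same rational given in normal form, where ℚ arithmetic computes.
  ι₀ : ℤ → ℚ
  ι₀ z = mkℚ z 0 (Coprimality.sym (Coprimality.1-coprimeTo ℤ.∣ z ∣))

  ι≡ι₀ : ∀ z → ι z ≡ ι₀ z
  ι≡ι₀ z = ℚ.↥p/↧p≡p (ι₀ z)

  ι-homo-+ : ∀ a b → ι (a ℤ.+ b) ≡ ι a ℚ.+ ι b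
  ι-homo-+ a b rewrite ι≡ι₀ a | ι≡ι₀ b | ℤ.*-identityʳ a | ℤ.*-identityʳ b = refl

  ι-homo-* : ∀ a b → ι (a ℤ.* b) ≡ ι a ℚ.* ι b
  ι-homo-* a b rewrite ι≡ι₀ a | ι≡ι₀ b = refl

  ι-homo-neg : ∀ a → ι (ℤ.- a) ≡ ℚ.- ι a
  ι-homo-neg a rewrite ι≡ι₀ a | ι≡ι₀ (ℤ.- a) = neg-ι₀ a
    where
    neg-ι₀ : ∀ a → ι₀ (ℤ.- a) ≡ ℚ.- ι₀ a
    neg-ι₀ (+ zero) = refl
    neg-ι₀ (+ suc n) = refl
    neg-ι₀ -[1+ n ] = refl

  ι-homo-- : ∀ a b → ι (a ℤ.- b) ≡ ι a ℚ.- ι b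
  ι-homo-- a b = trans (ι-homo-+ a (ℤ.- b)) (cong (ι a ℚ.+_) (ι-homo-neg b))

  ↥-ι : ∀ z → ↥ (ι z) ≡ z
  ↥-ι z rewrite ι≡ι₀ z = refl

  ι-injective : ∀ {a b} → ι a ≡ ι b → a ≡ b
  ι-injective {a} {b} eq = trans (sym (↥-ι a)) (trans (cong ↥_ eq) (↥-ι b))

  ι-nonZero : ∀ {z} → z ≢ + 0 → ι z ≢ 0ℚ
  ι-nonZero z≢0 eq = z≢0 (ι-injective eq)

  ι↧*p≡ι↥ : ∀ q → ι (↧ q) ℚ.* q ≡ ι (↥ q)
  ι↧*p≡ι↥ q@(mkℚ n dm _) rewrite ι≡ι₀ (↧ q) | ι≡ι₀ (↥ q) = ℚ.toℚᵘ-injective (ℚᵘ.≃-trans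
    (ℚ.toℚᵘ-homo-* (ι₀ (↧ q)) q)
    (*≡* (trans (ℤ.*-identityʳ (+ suc dm ℤ.* n))
                 (trans (ℤ.*-comm (+ suc dm) n) (cong (λ k → n ℤ.* + suc k) (sym (ℕ.+-identityʳ dm)))))))

  ι*p≡ι⇒*↥≡*↧ : ∀ {m n q} → ι m ℚ.* q ≡ ι n → m ℤ.* ↥ q ≡ n ℤ.* ↧ q
  ι*p≡ι⇒*↥≡*↧ {m} {n} {q} eq = ι-injective (begin
    ι (m ℤ.* ↥ q)            ≡⟨ ι-homo-* m (↥ q) ⟩
    ι m ℚ.* ι (↥ q)          ≡⟨ cong (ι m ℚ.*_) (sym (ι↧*p≡ι↥ q)) ⟩
    ι m ℚ.* (ι (↧ q) ℚ.* q)  ≡⟨ solve 3 (λ m d q → m :* (d :* q) := (m :* q) :* d) refl (ι m) (ι (↧ q)) q ⟩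
    (ι m ℚ.* q) ℚ.* ι (↧ q)  ≡⟨ cong (ℚ._* ι (↧ q)) eq ⟩
    ι n ℚ.* ι (↧ q)          ≡⟨ sym (ι-homo-* n (↧ q)) ⟩
    ι (n ℤ.* ↧ q)            ∎)
    where open ≡-Reasoning

  *-cancelˡ-≡ : ∀ {v} w w′ → v ≢ 0ℚ → v ℚ.* w ≡ v ℚ.* w′ → w ≡ w′
  *-cancelˡ-≡ {v} w w′ v≢0 eq = begin
    w                      ≡⟨ sym (1/v*[v*x]≡x w) ⟩
    ℚ.1/ v ℚ.* (v ℚ.* w)   ≡⟨ cong (ℚ.1/ v ℚ.*_) eq ⟩
    ℚ.1/ v ℚ.* (v ℚ.* w′)  ≡⟨ 1/v*[v*x]≡x w′ ⟩
    w′                     ∎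
    where
    open ≡-Reasoning
    instance _ = ℚ.≢-nonZero v≢0
    1/v*[v*x]≡x : ∀ x → ℚ.1/ v ℚ.* (v ℚ.* x) ≡ x
    1/v*[v*x]≡x x = trans (sym (ℚ.*-assoc (ℚ.1/ v) v x)) (trans (cong (ℚ._* x) (ℚ.*-inverseˡ v)) (ℚ.*-identityˡ x))

  *≡0⇒≡0 : ∀ {v} w → v ≢ 0ℚ → v ℚ.* w ≡ 0ℚ → w ≡ 0ℚ
  *≡0⇒≡0 {v} w v≢0 eq = *-cancelˡ-≡ w 0ℚ v≢0 (trans eq (sym (ℚ.*-zeroʳ v)))

module Localisation (p : ℕ) (p-prime : Prime p) where
  import Data.Nat.Base as ℕ

  import Data.Nat.Properties as ℕ
  open import Data.Nat.Divisibility using (_∣_; _∣?_; divides; ∣1⇒≡1; _∣0; m∣m*n; ∣n⇒∣m*n)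
  open import Data.Nat.Primality using (euclidsLemma; prime⇒nonTrivial)
  import Data.Nat.Coprimality as Coprimality
  open import Data.Integer.Base as ℤ using (ℤ; +_)
  import Data.Integer.Properties as ℤ
  open import Data.Rational.Base as ℚ using (ℚ; mkℚ; 0ℚ; 1ℚ; ↥_; ↧_; ↧ₙ_)
  import Data.Rational.Properties as ℚ
  open import Data.Product.Base using (Σ; _×_; _,_)
  open import Data.Sum.Base using (_⊎_; inj₁; inj₂; [_,_]′)
  open import Relation.Nullary using (¬_; yes; no)
  open import Relation.Binary.PropositionalEquality
  open import Data.Rational.Solver using (module +-*-Solver)
  open +-*-Solver

  open Rationals

  infix 4 p∤_
  p∤_ : ℤ → Set
  p∤ m = ¬ p ∣ ℤ.∣ m ∣

  record ℤ₍ₚ₎ (q : ℚ) : Set where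
    constructor mkℤ₍ₚ₎
    field
      m n : ℤ
      p∤m : p∤ m
      m*q≡n : ι m ℚ.* q ≡ ι n

  record pℤ₍ₚ₎ (q : ℚ) : Set where
    constructor mkpℤ₍ₚ₎
    field
      m n : ℤ
      p∤m : p∤ m
      m*q≡pn : ι m ℚ.* q ≡ ι (+ p ℤ.* n)

  p≢1 : p ≢ 1
  p≢1 refl with prime⇒nonTrivial p-prime
  ... | ()

  p∤1 : p∤ + 1
  p∤1 p∣1 = p≢1 (∣1⇒≡1 p∣1)

  p∤-* : ∀ {a b} → p∤ a → p∤ b → p∤ (a ℤ.* b)
  p∤-* {a} {b} p∤a p∤b p∣ab with euclidsLemma ℤ.∣ a ∣ ℤ.∣ b ∣ p-prime (subst (p ∣_) (ℤ.abs-* a b) p∣ab)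
  ... | inj₁ p∣a = p∤a p∣a
  ... | inj₂ p∣b = p∤b p∣b

  ℤ₍ₚ₎-ι : ∀ z → ℤ₍ₚ₎ (ι z)
  ℤ₍ₚ₎-ι z = mkℤ₍ₚ₎ (+ 1) z p∤1 (ℚ.*-identityˡ (ι z))

  pℤ₍ₚ₎⊆ℤ₍ₚ₎ : ∀ {q} → pℤ₍ₚ₎ q → ℤ₍ₚ₎ q
  pℤ₍ₚ₎⊆ℤ₍ₚ₎ (mkpℤ₍ₚ₎ m n p∤m eq) = mkℤ₍ₚ₎ m (+ p ℤ.* n) p∤m eq

  ℤ₍ₚ₎-+ : ∀ {q r} → ℤ₍ₚ₎ q → ℤ₍ₚ₎ r → ℤ₍ₚ₎ (q ℚ.+ r)
  ℤ₍ₚ₎-+ {q} {r} (mkℤ₍ₚ₎ m n p∤m eq) (mkℤ₍ₚ₎ m′ n′ p∤m′ eq′) =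
    mkℤ₍ₚ₎ (m ℤ.* m′) (n ℤ.* m′ ℤ.+ n′ ℤ.* m) (p∤-* {m} {m′} p∤m p∤m′) eq″
    where
    eq″ : ι (m ℤ.* m′) ℚ.* (q ℚ.+ r) ≡ ι (n ℤ.* m′ ℤ.+ n′ ℤ.* m)
    eq″ rewrite ι-homo-* m m′ | ι-homo-+ (n ℤ.* m′) (n′ ℤ.* m) | ι-homo-* n m′ | ι-homo-* n′ m | sym eq | sym eq′ =
      solve 4 (λ a b q r → (a :* b) :* (q :+ r) := (a :* q) :* b :+ (b :* r) :* a) refl (ι m) (ι m′) q r

  ℤ₍ₚ₎-* : ∀ {q r} → ℤ₍ₚ₎ q → ℤ₍ₚ₎ r → ℤ₍ₚ₎ (q ℚ.* r)
  ℤ₍ₚ₎-* {q} {r} (mkℤ₍ₚ₎ m n p∤m eq) (mkℤ₍ₚ₎ m′ n′ p∤m′ eq′) = mkℤ₍ₚ₎ (m ℤ.* m′) (n ℤ.* n′) (p∤-* {m} {m′} p∤m p∤m′) eq″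
    where
    eq″ : ι (m ℤ.* m′) ℚ.* (q ℚ.* r) ≡ ι (n ℤ.* n′)
    eq″ rewrite ι-homo-* m m′ | ι-homo-* n n′ | sym eq | sym eq′ =
      solve 4 (λ a b q r → (a :* b) :* (q :* r) := (a :* q) :* (b :* r)) refl (ι m) (ι m′) q r

  pℤ₍ₚ₎-+ : ∀ {q r} → pℤ₍ₚ₎ q → pℤ₍ₚ₎ r → pℤ₍ₚ₎ (q ℚ.+ r)
  pℤ₍ₚ₎-+ {q} {r} (mkpℤ₍ₚ₎ m n p∤m eq) (mkpℤ₍ₚ₎ m′ n′ p∤m′ eq′) =
    mkpℤ₍ₚ₎ (m ℤ.* m′) (n ℤ.* m′ ℤ.+ n′ ℤ.* m) (p∤-* {m} {m′} p∤m p∤m′) eq″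
    where
    open ≡-Reasoning
    P : ℚ
    P = ι (+ p)
    eq″ : ι (m ℤ.* m′) ℚ.* (q ℚ.+ r) ≡ ι (+ p ℤ.* (n ℤ.* m′ ℤ.+ n′ ℤ.* m))
    eq″ rewrite ι-homo-* m m′ | ι-homo-* (+ p) (n ℤ.* m′ ℤ.+ n′ ℤ.* m) | ι-homo-+ (n ℤ.* m′) (n′ ℤ.* m)
              | ι-homo-* n m′ | ι-homo-* n′ m = begin
      ι m ℚ.* ι m′ ℚ.* (q ℚ.+ r)                      ≡⟨ solve 4 (λ a b q r → (a :* b) :* (q :+ r) := (a :* q) :* b :+ (b :* r) :* a) refl (ι m) (ι m′) q r ⟩
      (ι m ℚ.* q) ℚ.* ι m′ ℚ.+ (ι m′ ℚ.* r) ℚ.* ι m   ≡⟨ cong₂ (λ x y → x ℚ.* ι m′ ℚ.+ y ℚ.* ι m) eq eq′ ⟩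
      ι (+ p ℤ.* n) ℚ.* ι m′ ℚ.+ ι (+ p ℤ.* n′) ℚ.* ι m  ≡⟨ cong₂ (λ x y → x ℚ.* ι m′ ℚ.+ y ℚ.* ι m) (ι-homo-* (+ p) n) (ι-homo-* (+ p) n′) ⟩
      P ℚ.* ι n ℚ.* ι m′ ℚ.+ P ℚ.* ι n′ ℚ.* ι m        ≡⟨ solve 5 (λ P a b c e → P :* a :* b :+ P :* c :* e := P :* (a :* b :+ c :* e)) refl P (ι n) (ι m′) (ι n′) (ι m) ⟩
      P ℚ.* (ι n ℚ.* ι m′ ℚ.+ ι n′ ℚ.* ι m)            ∎

  pℤ₍ₚ₎-*ʳ : ∀ {q r} → pℤ₍ₚ₎ q → ℤ₍ₚ₎ r → pℤ₍ₚ₎ (q ℚ.* r)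
  pℤ₍ₚ₎-*ʳ {q} {r} (mkpℤ₍ₚ₎ m n p∤m eq) (mkℤ₍ₚ₎ m′ n′ p∤m′ eq′) = mkpℤ₍ₚ₎ (m ℤ.* m′) (n ℤ.* n′) (p∤-* {m} {m′} p∤m p∤m′) eq″
    where
    open ≡-Reasoning
    eq″ : ι (m ℤ.* m′) ℚ.* (q ℚ.* r) ≡ ι (+ p ℤ.* (n ℤ.* n′))
    eq″ = begin
      ι (m ℤ.* m′) ℚ.* (q ℚ.* r)     ≡⟨ cong (ℚ._* (q ℚ.* r)) (ι-homo-* m m′) ⟩
      ι m ℚ.* ι m′ ℚ.* (q ℚ.* r)     ≡⟨ solve 4 (λ a b q r → (a :* b) :* (q :* r) := (a :* q) :* (b :* r)) refl (ι m) (ι m′) q r ⟩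
      (ι m ℚ.* q) ℚ.* (ι m′ ℚ.* r)   ≡⟨ cong₂ ℚ._*_ eq eq′ ⟩
      ι (+ p ℤ.* n) ℚ.* ι n′         ≡⟨ sym (ι-homo-* (+ p ℤ.* n) n′) ⟩
      ι (+ p ℤ.* n ℤ.* n′)           ≡⟨ cong ι (ℤ.*-assoc (+ p) n n′) ⟩
      ι (+ p ℤ.* (n ℤ.* n′))         ∎

  pℤ₍ₚ₎-*ˡ : ∀ {q r} → ℤ₍ₚ₎ q → pℤ₍ₚ₎ r → pℤ₍ₚ₎ (q ℚ.* r)
  pℤ₍ₚ₎-*ˡ {q} {r} q∈ℤ₍ₚ₎ r∈pℤ₍ₚ₎ = subst pℤ₍ₚ₎ (ℚ.*-comm r q) (pℤ₍ₚ₎-*ʳ r∈pℤ₍ₚ₎ q∈ℤ₍ₚ₎)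

  pℤ₍ₚ₎-neg : ∀ {q} → pℤ₍ₚ₎ q → pℤ₍ₚ₎ (ℚ.- q)
  pℤ₍ₚ₎-neg {q} q∈pℤ₍ₚ₎ = subst pℤ₍ₚ₎ (solve 1 (λ q → q :* :- con 1ℚ := :- q) refl q) (pℤ₍ₚ₎-*ʳ q∈pℤ₍ₚ₎ (ℤ₍ₚ₎-ι (ℤ.- + 1)))

  pℤ₍ₚ₎-0 : pℤ₍ₚ₎ 0ℚ
  pℤ₍ₚ₎-0 = mkpℤ₍ₚ₎ (+ 1) (+ 0) p∤1 (trans (ℚ.*-zeroʳ (ι (+ 1))) (cong ι (sym (ℤ.*-zeroʳ (+ p)))))

  1∉pℤ₍ₚ₎ : ¬ pℤ₍ₚ₎ 1ℚ
  1∉pℤ₍ₚ₎ (mkpℤ₍ₚ₎ m n p∤m eq) = p∤m (subst (λ k → p ∣ ℤ.∣ k ∣) (sym m≡pn) p∣pn)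
    where
    m≡pn : m ≡ + p ℤ.* n
    m≡pn = ι-injective (trans (sym (ℚ.*-identityʳ (ι m))) eq)
    p∣pn : p ∣ ℤ.∣ + p ℤ.* n ∣
    p∣pn = subst (p ∣_) (sym (ℤ.abs-* (+ p) n)) (m∣m*n ℤ.∣ n ∣)

  Inverse∈pℤ₍ₚ₎ : ℚ → Set
  Inverse∈pℤ₍ₚ₎ q = Σ ℚ λ r → pℤ₍ₚ₎ r × q ℚ.* r ≡ 1ℚ

  ℤ₍ₚ₎⊎Inverse∈pℤ₍ₚ₎ : ∀ q → ℤ₍ₚ₎ q ⊎ Inverse∈pℤ₍ₚ₎ q
  ℤ₍ₚ₎⊎Inverse∈pℤ₍ₚ₎ q@(mkℚ _ _ coprime) with p ∣? ↧ₙ q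
  ... | no p∤↧q = inj₁ (mkℤ₍ₚ₎ (↧ q) (↥ q) p∤↧q (ι↧*p≡ι↥ q))
  ... | yes (divides k ↧q≡kp) = inj₂ (ℚ.1/ q , mkpℤ₍ₚ₎ (↥ q) (+ k) p∤↥q ↥q*q⁻¹≡pk , ℚ.*-inverseʳ q)
    where
    open ≡-Reasoning
    p∤↥q : p∤ ↥ q
    p∤↥q p∣↥q = p≢1 (Coprimality.recompute coprime (p∣↥q , divides k ↧q≡kp))
    instance
      q≢0 : ℚ.NonZero q
      q≢0 = ℚ.≢-nonZero {q} λ q≡0 → p∤↥q (subst (λ z → p ∣ ℤ.∣ ↥ z ∣) (sym q≡0) (p ∣0))
    ↥q*q⁻¹≡pk : ι (↥ q) ℚ.* ℚ.1/ q ≡ ι (+ p ℤ.* + k)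
    ↥q*q⁻¹≡pk = begin
      ι (↥ q) ℚ.* ℚ.1/ q             ≡⟨ cong (ℚ._* ℚ.1/ q) (sym (ι↧*p≡ι↥ q)) ⟩
      ι (↧ q) ℚ.* q ℚ.* ℚ.1/ q       ≡⟨ ℚ.*-assoc (ι (↧ q)) q (ℚ.1/ q) ⟩
      ι (↧ q) ℚ.* (q ℚ.* ℚ.1/ q)     ≡⟨ cong (ι (↧ q) ℚ.*_) (ℚ.*-inverseʳ q) ⟩
      ι (↧ q) ℚ.* 1ℚ                 ≡⟨ ℚ.*-identityʳ _ ⟩
      ι (↧ q)                        ≡⟨ cong (λ z → ι (+ z)) (trans ↧q≡kp (ℕ.*-comm k p)) ⟩
      ι (+ (p ℕ.* k))                ≡⟨ cong ι (ℤ.pos-* p k) ⟩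
      ι (+ p ℤ.* + k)                ∎

  p∣↧⇒∉ℤ₍ₚ₎ : ∀ q → p ∣ ↧ₙ q → ¬ ℤ₍ₚ₎ q
  p∣↧⇒∉ℤ₍ₚ₎ q@(mkℚ _ _ coprime) p∣↧q (mkℤ₍ₚ₎ m n p∤m eq) =
    [ p∤m , (λ p∣↥q → p≢1 (Coprimality.recompute coprime (p∣↥q , p∣↧q))) ]′
      (euclidsLemma ℤ.∣ m ∣ ℤ.∣ ↥ q ∣ p-prime p∣m↥q)
    where
    p∣m↥q : p ∣ ℤ.∣ m ∣ ℕ.* ℤ.∣ ↥ q ∣
    p∣m↥q = subst (p ∣_) (trans (cong ℤ.∣_∣ (sym (ι*p≡ι⇒*↥≡*↧ {m} {n} {q} eq))) (ℤ.abs-* m (↥ q)))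
              (subst (p ∣_) (sym (ℤ.abs-* n (↧ q))) (∣n⇒∣m*n ℤ.∣ n ∣ p∣↧q))

module LocalToGlobal where
  open import Data.Nat.Base as ℕ using (ℕ; zero; suc)
  open import Data.Nat.ListAction using (product)
  open import Data.Nat.Divisibility using (_∣_; divides)
  open import Data.Nat.Primality using (Prime)
  open import Data.Nat.Primality.Factorisation using (factorise; PrimeFactorisation)
  import Data.Nat.Properties as ℕ
  open import Data.List.Base using (_∷_)
  open import Data.List.Relation.Unary.All using (All; _∷_)
  open import Data.Rational.Base using (mkℚ)
  open import Data.Product.Base using (Σ; _×_; _,_)
  open import Data.Empty using (⊥-elim)
  open import Relation.Binary.PropositionalEquality

  open Rationals
  open Localisation

  prime-divisor : ∀ k → Σ ℕ λ p → Prime p × p ∣ 2 ℕ.+ k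
  prime-divisor k = from-factors (PrimeFactorisation.factors f)
    (PrimeFactorisation.isFactorisation f) (PrimeFactorisation.factorsPrime f)
    where
    n : ℕ
    n = 2 ℕ.+ k
    f : PrimeFactorisation n
    f = factorise n
    from-factors : ∀ ps → n ≡ product ps → All Prime ps → Σ ℕ λ p → Prime p × p ∣ n
    from-factors (p ∷ ps) n≡p*ps (p-prime ∷ _) = p , p-prime , divides (product ps) (trans n≡p*ps (ℕ.*-comm p _))

  locally-integer⇒integer : ∀ q → (∀ p (p-prime : Prime p) → ℤ₍ₚ₎ p p-prime q) → IsInteger q
  locally-integer⇒integer (mkℚ n zero _) _ = n , sym (ι≡ι₀ n)
  locally-integer⇒integer q@(mkℚ _ (suc d) _) local with prime-divisor d
  ... | p , p-prime , p∣↧q = ⊥-elim (p∣↧⇒∉ℤ₍ₚ₎ p p-prime q p∣↧q (local p p-prime))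

module SquareFreeness where
  import Data.Nat.Base as ℕ
  import Data.Nat.Properties as ℕ
  open import Data.Nat.Divisibility using (_∣_; divides; ∣-trans; m∣m*n; *-cancelˡ-∣)
  open import Data.Nat.Primality using (Prime; euclidsLemma; prime⇒nonZero)
  open import Data.Integer.Base as ℤ using (ℤ; +_)
  import Data.Integer.Properties as ℤ
  open import Data.Rational.Base as ℚ using (ℚ; 1ℚ)
  import Data.Rational.Properties as ℚ
  open import Data.Product.Base using (_,_)
  open import Data.Sum.Base using (inj₁; inj₂; [_,_]′)
  open import Data.Empty using (⊥-elim)
  open import Relation.Nullary using (¬_)
  open import Relation.Binary.PropositionalEquality
  open import Data.Nat.Solver using (module +-*-Solver)
  import Data.Rational.Solver as ℚ-Solver

  open Rationals
  open Localisation
  open LocalToGlobal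

  p²∣dm²⇒p²∣d : ∀ {p d m} → Prime p → ¬ p ∣ m → p ℕ.* p ∣ d ℕ.* (m ℕ.* m) → p ℕ.* p ∣ d
  p²∣dm²⇒p²∣d {p} {d} {m} p-prime p∤m p²∣dm² with euclidsLemma d (m ℕ.* m) p-prime (∣-trans (m∣m*n p) p²∣dm²)
  ... | inj₂ p∣m² = ⊥-elim ([ p∤m , p∤m ]′ (euclidsLemma m m p-prime p∣m²))
  ... | inj₁ (divides k refl) with euclidsLemma k (m ℕ.* m) p-prime (*-cancelˡ-∣ p {{prime⇒nonZero p-prime}} p²∣pkm²)
    where
    open +-*-Solver
    p²∣pkm² : p ℕ.* p ∣ p ℕ.* (k ℕ.* (m ℕ.* m))
    p²∣pkm² = subst (p ℕ.* p ∣_) (solve 3 (λ k p m → k :* p :* (m :* m) := p :* (k :* (m :* m))) refl k p m) p²∣dm²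
  ...   | inj₂ p∣m² = ⊥-elim ([ p∤m , p∤m ]′ (euclidsLemma m m p-prime p∣m²))
  ...   | inj₁ (divides k′ refl) = divides k′ (ℕ.*-assoc k′ p p)

  private
    m²d≡Z[pn]² : ∀ {d p r s Z} m n → ι (+ d) ℚ.* (r ℚ.* r) ≡ ι Z → r ℚ.* s ≡ 1ℚ → ι m ℚ.* s ≡ ι (+ p ℤ.* n) →
                 m ℤ.* m ℤ.* + d ≡ Z ℤ.* ((+ p ℤ.* n) ℤ.* (+ p ℤ.* n))
    m²d≡Z[pn]² {d} {p} {r} {s} {Z} m n dr²≡Z rs≡1 ms≡pn = ι-injective (begin
      ι (m ℤ.* m ℤ.* + d)                                ≡⟨ trans (ι-homo-* (m ℤ.* m) (+ d)) (cong (ℚ._* D) (ι-homo-* m m)) ⟩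
      ι m ℚ.* ι m ℚ.* D                                  ≡⟨ sym (ℚ.*-identityʳ _) ⟩
      ι m ℚ.* ι m ℚ.* D ℚ.* 1ℚ                           ≡⟨ cong (λ t → ι m ℚ.* ι m ℚ.* D ℚ.* (t ℚ.* t)) (sym rs≡1) ⟩
      ι m ℚ.* ι m ℚ.* D ℚ.* ((r ℚ.* s) ℚ.* (r ℚ.* s))     ≡⟨ solve 4 (λ M D r s → M :* M :* D :* ((r :* s) :* (r :* s)) := (D :* (r :* r)) :* ((M :* s) :* (M :* s))) refl (ι m) D r s ⟩
      (D ℚ.* (r ℚ.* r)) ℚ.* ((ι m ℚ.* s) ℚ.* (ι m ℚ.* s)) ≡⟨ cong₂ (λ a b → a ℚ.* (b ℚ.* b)) dr²≡Z ms≡pn ⟩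
      ι Z ℚ.* (ι (+ p ℤ.* n) ℚ.* ι (+ p ℤ.* n))           ≡⟨ sym (trans (ι-homo-* Z _) (cong (ι Z ℚ.*_) (ι-homo-* (+ p ℤ.* n) (+ p ℤ.* n)))) ⟩
      ι (Z ℤ.* ((+ p ℤ.* n) ℤ.* (+ p ℤ.* n)))             ∎)
      where
      open ≡-Reasoning
      open ℚ-Solver.+-*-Solver
      D = ι (+ d)

  squarefree⇒integer : ∀ {d} → SquareFree d → ∀ r Z → ι (+ d) ℚ.* (r ℚ.* r) ≡ ι Z → IsInteger r
  squarefree⇒integer {d} squarefree r Z dr²≡Z = locally-integer⇒integer r r∈ℤ₍ₚ₎
    where
    r∈ℤ₍ₚ₎ : ∀ p p-prime → ℤ₍ₚ₎ p p-prime r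
    r∈ℤ₍ₚ₎ p p-prime with ℤ₍ₚ₎⊎Inverse∈pℤ₍ₚ₎ p p-prime r
    ... | inj₁ r∈ℤ₍ₚ₎ = r∈ℤ₍ₚ₎
    ... | inj₂ (s , mkpℤ₍ₚ₎ m n p∤m ms≡pn , rs≡1) = ⊥-elim (p≢1 p p-prime (squarefree p (p²∣dm²⇒p²∣d p-prime p∤m p²∣dm²)))
      where
      open ≡-Reasoning
      open +-*-Solver
      p²∣dm² : p ℕ.* p ∣ d ℕ.* (ℤ.∣ m ∣ ℕ.* ℤ.∣ m ∣)
      p²∣dm² = divides (ℤ.∣ Z ∣ ℕ.* (ℤ.∣ n ∣ ℕ.* ℤ.∣ n ∣)) (begin
        d ℕ.* (ℤ.∣ m ∣ ℕ.* ℤ.∣ m ∣)                              ≡⟨ ℕ.*-comm d _ ⟩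
        ℤ.∣ m ∣ ℕ.* ℤ.∣ m ∣ ℕ.* d                                ≡⟨ sym (trans (ℤ.abs-* (m ℤ.* m) (+ d)) (cong (ℕ._* d) (ℤ.abs-* m m))) ⟩
        ℤ.∣ m ℤ.* m ℤ.* + d ∣                                     ≡⟨ cong ℤ.∣_∣ (m²d≡Z[pn]² {d} {p} {r} {s} {Z} m n dr²≡Z rs≡1 ms≡pn) ⟩
        ℤ.∣ Z ℤ.* ((+ p ℤ.* n) ℤ.* (+ p ℤ.* n)) ∣                 ≡⟨ trans (ℤ.abs-* Z _) (cong (ℤ.∣ Z ∣ ℕ.*_) (trans (ℤ.abs-* (+ p ℤ.* n) (+ p ℤ.* n))
                                                                       (cong₂ ℕ._*_ (ℤ.abs-* (+ p) n) (ℤ.abs-* (+ p) n)))) ⟩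
        ℤ.∣ Z ∣ ℕ.* ((p ℕ.* ℤ.∣ n ∣) ℕ.* (p ℕ.* ℤ.∣ n ∣))         ≡⟨ solve 3 (λ z p n → z :* ((p :* n) :* (p :* n)) := z :* (n :* n) :* (p :* p)) refl ℤ.∣ Z ∣ p ℤ.∣ n ∣ ⟩
        ℤ.∣ Z ∣ ℕ.* (ℤ.∣ n ∣ ℕ.* ℤ.∣ n ∣) ℕ.* (p ℕ.* p)           ∎)

module QuadraticField (d : ℕ) where
  open import Data.Integer.Base using (+_)
  open import Data.List.Base using ([]; _∷_; length)
  open import Data.Rational.Base as ℚ using (ℚ; 0ℚ; 1ℚ)
  import Data.Rational.Properties as ℚ
  open import Data.Product.Base using (_×_; _,_; proj₁; proj₂)
  open import Relation.Binary.PropositionalEquality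
  open import Level using (0ℓ)
  open import Algebra.Bundles using (CommutativeSemigroup)
  import Algebra.Properties.CommutativeSemigroup as CommutativeSemigroupProperties
  open import Data.Rational.Solver using (module +-*-Solver)
  open +-*-Solver

  open Rationals

  infixl 7 _⊗_
  infixl 6 _⊕_

  _⊗_ : K → K → K
  _⊗_ = mulK d

  _⊕_ : K → K → K
  _⊕_ = addK

  D : ℚ
  D = ι (+ d)

  trace : K → ℚ
  trace x = re x ℚ.+ re x

  norm : K → ℚ
  norm x = re x ℚ.* re x ℚ.+ D ℚ.* (im x ℚ.* im x)

  conj : K → K
  conj x = re x +√-d· (ℚ.- im x)

  K-ext : ∀ {x y : K} → re x ≡ re y → im x ≡ im y → x ≡ y
  K-ext {_ +√-d· _} {_ +√-d· _} refl refl = refl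

  -- Identities in K are proved coordinatewise by the ring solver for ℚ, on these coordinate expressions.
  Polynomialᴷ : ℕ → Set
  Polynomialᴷ n = Polynomial n × Polynomial n

  _⊕ᴾ_ : ∀ {n} → Polynomialᴷ n → Polynomialᴷ n → Polynomialᴷ n
  (a , b) ⊕ᴾ (c , e) = a :+ c , b :+ e

  mulᴾ : ∀ {n} → Polynomial n → Polynomialᴷ n → Polynomialᴷ n → Polynomialᴷ n
  mulᴾ D (a , b) (c , e) = a :* c :- D :* (b :* e) , a :* e :+ b :* c

  ⊗-comm : ∀ x y → x ⊗ y ≡ y ⊗ x
  ⊗-comm (a +√-d· b) (c +√-d· e) = K-ext
    (solve 5 (λ a b c e D → proj₁ (mulᴾ D (a , b) (c , e)) := proj₁ (mulᴾ D (c , e) (a , b))) refl a b c e D)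
    (solve 5 (λ a b c e D → proj₂ (mulᴾ D (a , b) (c , e)) := proj₂ (mulᴾ D (c , e) (a , b))) refl a b c e D)

  ⊗-assoc : ∀ x y z → (x ⊗ y) ⊗ z ≡ x ⊗ (y ⊗ z)
  ⊗-assoc (a +√-d· b) (c +√-d· e) (f +√-d· g) = K-ext
    (solve 7 (λ a b c e f g D → proj₁ (mulᴾ D (mulᴾ D (a , b) (c , e)) (f , g)) := proj₁ (mulᴾ D (a , b) (mulᴾ D (c , e) (f , g)))) refl a b c e f g D)
    (solve 7 (λ a b c e f g D → proj₂ (mulᴾ D (mulᴾ D (a , b) (c , e)) (f , g)) := proj₂ (mulᴾ D (a , b) (mulᴾ D (c , e) (f , g)))) refl a b c e f g D)

  ⊗-distribˡ-⊕ : ∀ x y z → x ⊗ (y ⊕ z) ≡ x ⊗ y ⊕ x ⊗ z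
  ⊗-distribˡ-⊕ (a +√-d· b) (c +√-d· e) (f +√-d· g) = K-ext
    (solve 7 (λ a b c e f g D → proj₁ (mulᴾ D (a , b) ((c , e) ⊕ᴾ (f , g))) := proj₁ (mulᴾ D (a , b) (c , e) ⊕ᴾ mulᴾ D (a , b) (f , g))) refl a b c e f g D)
    (solve 7 (λ a b c e f g D → proj₂ (mulᴾ D (a , b) ((c , e) ⊕ᴾ (f , g))) := proj₂ (mulᴾ D (a , b) (c , e) ⊕ᴾ mulᴾ D (a , b) (f , g))) refl a b c e f g D)

  ιℚ-⊗ : ∀ u x → ιℚ u ⊗ x ≡ (u ℚ.* re x) +√-d· (u ℚ.* im x)
  ιℚ-⊗ u (a +√-d· b) = K-ext
    (solve 4 (λ u a b D → proj₁ (mulᴾ D (u , con 0ℚ) (a , b)) := u :* a) refl u a b D)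
    (solve 4 (λ u a b D → proj₂ (mulᴾ D (u , con 0ℚ) (a , b)) := u :* b) refl u a b D)

  ιℚ-homo-* : ∀ u v → ιℚ u ⊗ ιℚ v ≡ ιℚ (u ℚ.* v)
  ιℚ-homo-* u v = trans (ιℚ-⊗ u (ιℚ v)) (cong ((u ℚ.* v) +√-d·_) (ℚ.*-zeroʳ u))

  ⊗-identityˡ : ∀ x → 1K ⊗ x ≡ x
  ⊗-identityˡ x = trans (ιℚ-⊗ 1ℚ x) (K-ext (ℚ.*-identityˡ (re x)) (ℚ.*-identityˡ (im x)))

  ⊗-zeroˡ : ∀ x → 0K ⊗ x ≡ 0K
  ⊗-zeroˡ x = trans (ιℚ-⊗ 0ℚ x) (K-ext (ℚ.*-zeroˡ (re x)) (ℚ.*-zeroˡ (im x)))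

  ⊗-zeroʳ : ∀ x → x ⊗ 0K ≡ 0K
  ⊗-zeroʳ x = trans (⊗-comm x 0K) (⊗-zeroˡ x)

  norm-homo-* : ∀ x y → norm (x ⊗ y) ≡ norm x ℚ.* norm y
  norm-homo-* (a +√-d· b) (c +√-d· e) = solve 5 (λ a b c e D →
    let r = proj₁ (mulᴾ D (a , b) (c , e)) ; s = proj₂ (mulᴾ D (a , b) (c , e)) in
    r :* r :+ D :* (s :* s) := (a :* a :+ D :* (b :* b)) :* (c :* c :+ D :* (e :* e))) refl a b c e D

  norm-1 : norm 1K ≡ 1ℚ
  norm-1 = solve 1 (λ D → con 1ℚ :* con 1ℚ :+ D :* (con 0ℚ :* con 0ℚ) := con 1ℚ) refl D

  trace-scale : ∀ c x → trace (ιℚ c ⊗ x) ≡ c ℚ.* trace x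
  trace-scale c (a +√-d· b) = solve 4 (λ c a b D →
    let r = proj₁ (mulᴾ D (c , con 0ℚ) (a , b)) in r :+ r := c :* (a :+ a)) refl c a b D

  norm-scale : ∀ c x → norm (ιℚ c ⊗ x) ≡ c ℚ.* c ℚ.* norm x
  norm-scale c (a +√-d· b) = solve 4 (λ c a b D →
    let r = proj₁ (mulᴾ D (c , con 0ℚ) (a , b)) ; s = proj₂ (mulᴾ D (c , con 0ℚ) (a , b)) in
    r :* r :+ D :* (s :* s) := c :* c :* (a :* a :+ D :* (b :* b))) refl c a b D

  norm-conj : ∀ x → norm (conj x) ≡ norm x
  norm-conj x = solve 3 (λ a b D → a :* a :+ D :* (:- b :* :- b) := a :* a :+ D :* (b :* b)) refl (re x) (im x) D

  conj-⊗ : ∀ x → conj x ⊗ x ≡ ιℚ (norm x)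
  conj-⊗ (a +√-d· b) = K-ext
    (solve 3 (λ a b D → proj₁ (mulᴾ D (a , :- b) (a , b)) := a :* a :+ D :* (b :* b)) refl a b D)
    (solve 3 (λ a b D → proj₂ (mulᴾ D (a , :- b) (a , b)) := con 0ℚ) refl a b D)

  ⊗-commutativeSemigroup : CommutativeSemigroup 0ℓ 0ℓ
  ⊗-commutativeSemigroup = record
    { isCommutativeSemigroup = record
      { isSemigroup = record { isMagma = record { isEquivalence = isEquivalence ; ∙-cong = cong₂ _⊗_ } ; assoc = ⊗-assoc }
      ; comm = ⊗-comm } }

  pow-⊗-evalMonic-∷ : ∀ y x c cs → let Y = powK d y (length cs) ; H = evalMonic d cs x in
    (y ⊗ Y) ⊗ evalMonic d (c ∷ cs) x ≡ ιℤ c ⊗ (y ⊗ Y) ⊕ (y ⊗ x) ⊗ (Y ⊗ H)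
  pow-⊗-evalMonic-∷ y x c cs = trans (⊗-distribˡ-⊕ (y ⊗ Y) (ιℤ c) (x ⊗ H))
    (cong₂ _⊕_ (⊗-comm (y ⊗ Y) (ιℤ c)) (interchange y Y x H))
    where
    Y : K
    Y = powK d y (length cs)
    H : K
    H = evalMonic d cs x
    open CommutativeSemigroupProperties ⊗-commutativeSemigroup using (interchange)

  -- y^(deg f) f(x) is built from 1 by the steps E ↦ c y^(k+1) + (y x) E, one for each coefficient c of f.
  integral⇒invariant-at-0 : ∀ (P : K → Set) y x → P 1K →
    (∀ c k {E} → P E → P (ιℤ c ⊗ (y ⊗ powK d y k) ⊕ (y ⊗ x) ⊗ E)) →
    IsIntegral d x → P 0K
  integral⇒invariant-at-0 P y x P-1 P-step (cs , f[x]≡0) =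
    subst P (trans (cong (powK d y (length cs) ⊗_) f[x]≡0) (⊗-zeroʳ (powK d y (length cs)))) (P-pow⊗eval cs)
    where
    P-pow⊗eval : ∀ cs → P (powK d y (length cs) ⊗ evalMonic d cs x)
    P-pow⊗eval [] = subst P (sym (⊗-identityˡ 1K)) P-1
    P-pow⊗eval (c ∷ cs) = subst P (sym (pow-⊗-evalMonic-∷ y x c cs)) (P-step c (length cs) (P-pow⊗eval cs))

module LocalIntegrality (d p : ℕ) (p-prime : Prime p) where
  open import Data.Nat.Base using (zero; suc)
  open import Data.Integer.Base using (+_)
  open import Data.Rational.Base as ℚ using (ℚ; 0ℚ; 1ℚ)
  import Data.Rational.Properties as ℚ
  open import Data.Product.Base using (Σ; _×_; _,_; proj₁; proj₂)
  open import Data.Sum.Base using (_⊎_; inj₁; inj₂; [_,_]′)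
  open import Data.Empty using (⊥-elim)
  open import Relation.Nullary using (¬_; yes; no)
  open import Function.Base using (_$_)
  open import Relation.Binary.PropositionalEquality
  open import Data.Rational.Solver using (module +-*-Solver)
  open +-*-Solver

  open Rationals
  open QuadraticField d
  open Localisation p p-prime

  record 1+pℤ₍ₚ₎ (q : ℚ) : Set where
    constructor 1+
    field
      q-1∈pℤ₍ₚ₎ : pℤ₍ₚ₎ (q ℚ.- 1ℚ)

  1∈1+pℤ₍ₚ₎ : 1+pℤ₍ₚ₎ 1ℚ
  1∈1+pℤ₍ₚ₎ = 1+ (subst pℤ₍ₚ₎ (sym (ℚ.+-inverseʳ 1ℚ)) pℤ₍ₚ₎-0)

  0∉1+pℤ₍ₚ₎ : ¬ 1+pℤ₍ₚ₎ 0ℚ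
  0∉1+pℤ₍ₚ₎ (1+ h) = 1∉pℤ₍ₚ₎ (subst pℤ₍ₚ₎ (solve 0 (:- (con 0ℚ :- con 1ℚ) := con 1ℚ) refl) (pℤ₍ₚ₎-neg h))

  1+pℤ₍ₚ₎⊆ℤ₍ₚ₎ : ∀ {q} → 1+pℤ₍ₚ₎ q → ℤ₍ₚ₎ q
  1+pℤ₍ₚ₎⊆ℤ₍ₚ₎ {q} (1+ h) = subst ℤ₍ₚ₎ (solve 1 (λ q → q :- con 1ℚ :+ con 1ℚ := q) refl q) (ℤ₍ₚ₎-+ (pℤ₍ₚ₎⊆ℤ₍ₚ₎ h) (ℤ₍ₚ₎-ι (+ 1)))

  pℤ₍ₚ₎-+-1+pℤ₍ₚ₎ : ∀ {q r} → pℤ₍ₚ₎ q → 1+pℤ₍ₚ₎ r → 1+pℤ₍ₚ₎ (q ℚ.+ r)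
  pℤ₍ₚ₎-+-1+pℤ₍ₚ₎ {q} {r} hq (1+ hr) = 1+ $ subst pℤ₍ₚ₎ (solve 2 (λ q r → q :+ (r :- con 1ℚ) := q :+ r :- con 1ℚ) refl q r) (pℤ₍ₚ₎-+ hq hr)

  1+pℤ₍ₚ₎-+-pℤ₍ₚ₎ : ∀ {q r} → 1+pℤ₍ₚ₎ q → pℤ₍ₚ₎ r → 1+pℤ₍ₚ₎ (q ℚ.+ r)
  1+pℤ₍ₚ₎-+-pℤ₍ₚ₎ {q} {r} hq hr = subst 1+pℤ₍ₚ₎ (ℚ.+-comm r q) (pℤ₍ₚ₎-+-1+pℤ₍ₚ₎ hr hq)

  lin : ℚ → ℚ → K → K
  lin u₀ u₁ w = ιℚ u₀ ⊕ ιℚ u₁ ⊗ w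

  infix 4 _∈_∔_·_
  _∈_∔_·_ : K → (ℚ → Set) → (ℚ → Set) → K → Set
  E ∈ A ∔ B · w = Σ ℚ λ u₀ → Σ ℚ λ u₁ → A u₀ × B u₁ × E ≡ lin u₀ u₁ w

  lin-components : ∀ u₀ u₁ w → lin u₀ u₁ w ≡ (u₀ ℚ.+ u₁ ℚ.* re w) +√-d· (u₁ ℚ.* im w)
  lin-components u₀ u₁ w = trans (cong (ιℚ u₀ ⊕_) (ιℚ-⊗ u₁ w)) (K-ext refl (ℚ.+-identityˡ (u₁ ℚ.* im w)))

  ιℚ≡lin : ∀ r w → ιℚ r ≡ lin r 0ℚ w
  ιℚ≡lin r w = sym (trans (lin-components r 0ℚ w)
    (K-ext (trans (cong (r ℚ.+_) (ℚ.*-zeroˡ (re w))) (ℚ.+-identityʳ r)) (ℚ.*-zeroˡ (im w))))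

  ≡lin : ∀ w → w ≡ lin 0ℚ 1ℚ w
  ≡lin w = sym (trans (lin-components 0ℚ 1ℚ w)
    (K-ext (trans (ℚ.+-identityˡ _) (ℚ.*-identityˡ (re w))) (ℚ.*-identityˡ (im w))))

  ⊗-lin : ∀ w u₀ u₁ → w ⊗ lin u₀ u₁ w ≡ lin (u₁ ℚ.* ℚ.- norm w) (u₀ ℚ.+ u₁ ℚ.* trace w) w
  ⊗-lin (a +√-d· b) u₀ u₁ = K-ext
    (solve 5 (λ u₀ u₁ a b D → proj₁ (mulᴾ D (a , b) ((u₀ , con 0ℚ) ⊕ᴾ mulᴾ D (u₁ , con 0ℚ) (a , b)))
      := proj₁ ((u₁ :* :- (a :* a :+ D :* (b :* b)) , con 0ℚ) ⊕ᴾ mulᴾ D (u₀ :+ u₁ :* (a :+ a) , con 0ℚ) (a , b))) refl u₀ u₁ a b D)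
    (solve 5 (λ u₀ u₁ a b D → proj₂ (mulᴾ D (a , b) ((u₀ , con 0ℚ) ⊕ᴾ mulᴾ D (u₁ , con 0ℚ) (a , b)))
      := proj₂ ((u₁ :* :- (a :* a :+ D :* (b :* b)) , con 0ℚ) ⊕ᴾ mulᴾ D (u₀ :+ u₁ :* (a :+ a) , con 0ℚ) (a , b))) refl u₀ u₁ a b D)

  ιℚ-⊗-lin : ∀ c u₀ u₁ w → ιℚ c ⊗ lin u₀ u₁ w ≡ lin (c ℚ.* u₀) (c ℚ.* u₁) w
  ιℚ-⊗-lin c u₀ u₁ (a +√-d· b) = K-ext
    (solve 6 (λ c u₀ u₁ a b D → proj₁ (mulᴾ D (c , con 0ℚ) ((u₀ , con 0ℚ) ⊕ᴾ mulᴾ D (u₁ , con 0ℚ) (a , b)))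
      := proj₁ ((c :* u₀ , con 0ℚ) ⊕ᴾ mulᴾ D (c :* u₁ , con 0ℚ) (a , b))) refl c u₀ u₁ a b D)
    (solve 6 (λ c u₀ u₁ a b D → proj₂ (mulᴾ D (c , con 0ℚ) ((u₀ , con 0ℚ) ⊕ᴾ mulᴾ D (u₁ , con 0ℚ) (a , b)))
      := proj₂ ((c :* u₀ , con 0ℚ) ⊕ᴾ mulᴾ D (c :* u₁ , con 0ℚ) (a , b))) refl c u₀ u₁ a b D)

  lin-⊕-lin : ∀ u₀ u₁ v₀ v₁ w → lin u₀ u₁ w ⊕ lin v₀ v₁ w ≡ lin (u₀ ℚ.+ v₀) (u₁ ℚ.+ v₁) w
  lin-⊕-lin u₀ u₁ v₀ v₁ (a +√-d· b) = K-ext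
    (solve 7 (λ u₀ u₁ v₀ v₁ a b D → proj₁ (((u₀ , con 0ℚ) ⊕ᴾ mulᴾ D (u₁ , con 0ℚ) (a , b)) ⊕ᴾ ((v₀ , con 0ℚ) ⊕ᴾ mulᴾ D (v₁ , con 0ℚ) (a , b)))
      := proj₁ ((u₀ :+ v₀ , con 0ℚ) ⊕ᴾ mulᴾ D (u₁ :+ v₁ , con 0ℚ) (a , b))) refl u₀ u₁ v₀ v₁ a b D)
    (solve 7 (λ u₀ u₁ v₀ v₁ a b D → proj₂ (((u₀ , con 0ℚ) ⊕ᴾ mulᴾ D (u₁ , con 0ℚ) (a , b)) ⊕ᴾ ((v₀ , con 0ℚ) ⊕ᴾ mulᴾ D (v₁ , con 0ℚ) (a , b)))
      := proj₂ ((u₀ :+ v₀ , con 0ℚ) ⊕ᴾ mulᴾ D (u₁ :+ v₁ , con 0ℚ) (a , b))) refl u₀ u₁ v₀ v₁ a b D)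

  lin≡0⇒≡0 : ∀ {u₀ u₁ w} → im w ≢ 0ℚ → 0K ≡ lin u₀ u₁ w → u₀ ≡ 0ℚ × u₁ ≡ 0ℚ
  lin≡0⇒≡0 {u₀} {u₁} {w} im≢0 0≡lin = u₀≡0 , u₁≡0
    where
    0≡components : 0K ≡ (u₀ ℚ.+ u₁ ℚ.* re w) +√-d· (u₁ ℚ.* im w)
    0≡components = trans 0≡lin (lin-components u₀ u₁ w)
    u₁≡0 : u₁ ≡ 0ℚ
    u₁≡0 = *≡0⇒≡0 u₁ im≢0 (trans (ℚ.*-comm (im w) u₁) (sym (cong im 0≡components)))
    u₀≡0 : u₀ ≡ 0ℚ
    u₀≡0 = begin
      u₀                    ≡⟨ sym (ℚ.+-identityʳ u₀) ⟩
      u₀ ℚ.+ 0ℚ             ≡⟨ cong (u₀ ℚ.+_) (sym (ℚ.*-zeroˡ (re w))) ⟩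
      u₀ ℚ.+ 0ℚ ℚ.* re w    ≡⟨ cong (λ v → u₀ ℚ.+ v ℚ.* re w) (sym u₁≡0) ⟩
      u₀ ℚ.+ u₁ ℚ.* re w    ≡⟨ sym (cong re 0≡components) ⟩
      0ℚ                    ∎
      where open ≡-Reasoning

  module _ {A B A′ B′ : ℚ → Set} {w : K} where

    ∔-⊗ : (∀ {u₀ u₁} → A u₀ → B u₁ → A′ (u₁ ℚ.* ℚ.- norm w)) →
          (∀ {u₀ u₁} → A u₀ → B u₁ → B′ (u₀ ℚ.+ u₁ ℚ.* trace w)) →
          ∀ {E} → E ∈ A ∔ B · w → w ⊗ E ∈ A′ ∔ B′ · w
    ∔-⊗ f g (u₀ , u₁ , h₀ , h₁ , refl) = _ , _ , f h₀ h₁ , g h₀ h₁ , ⊗-lin w u₀ u₁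

    ∔-scale : ∀ c → (∀ {u} → A u → A′ (c ℚ.* u)) → (∀ {u} → B u → B′ (c ℚ.* u)) →
              ∀ {E} → E ∈ A ∔ B · w → ιℚ c ⊗ E ∈ A′ ∔ B′ · w
    ∔-scale c f g (u₀ , u₁ , h₀ , h₁ , refl) = _ , _ , f h₀ , g h₁ , ιℚ-⊗-lin c u₀ u₁ w

    module _ {A″ B″ : ℚ → Set} where

      ∔-⊕ : (∀ {u v} → A u → A′ v → A″ (u ℚ.+ v)) → (∀ {u v} → B u → B′ v → B″ (u ℚ.+ v)) →
            ∀ {E F} → E ∈ A ∔ B · w → F ∈ A′ ∔ B′ · w → E ⊕ F ∈ A″ ∔ B″ · w
      ∔-⊕ f g (u₀ , u₁ , h₀ , h₁ , refl) (v₀ , v₁ , k₀ , k₁ , refl) = _ , _ , f h₀ k₀ , g h₁ k₁ , lin-⊕-lin u₀ u₁ v₀ v₁ w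

  -- y² = τ y − ν with ν ∈ pℤ₍ₚ₎ keeps every y^(k+1) in pℤ₍ₚ₎ + ℤ₍ₚ₎ y, so y^(deg f) f(x) stays in 1 + pℤ₍ₚ₎ + ℤ₍ₚ₎ y.
  unit-case : ∀ x y → y ⊗ x ≡ 1K → ℤ₍ₚ₎ (trace y) → pℤ₍ₚ₎ (norm y) → IsIntegral d x →
              0K ∈ 1+pℤ₍ₚ₎ ∔ ℤ₍ₚ₎ · y
  unit-case x y y⊗x≡1 τ∈ℤ₍ₚ₎ ν∈pℤ = integral⇒invariant-at-0 (_∈ 1+pℤ₍ₚ₎ ∔ ℤ₍ₚ₎ · y) y x
    (1ℚ , 0ℚ , 1∈1+pℤ₍ₚ₎ , ℤ₍ₚ₎-ι (+ 0) , ιℚ≡lin 1ℚ y) step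
    where
    y⊗pow : ∀ k → y ⊗ powK d y k ∈ pℤ₍ₚ₎ ∔ ℤ₍ₚ₎ · y
    y⊗pow zero = subst (_∈ pℤ₍ₚ₎ ∔ ℤ₍ₚ₎ · y) (sym (trans (⊗-comm y 1K) (⊗-identityˡ y)))
      (0ℚ , 1ℚ , pℤ₍ₚ₎-0 , ℤ₍ₚ₎-ι (+ 1) , ≡lin y)
    y⊗pow (suc k) = ∔-⊗ (λ _ u₁∈ → pℤ₍ₚ₎-*ˡ u₁∈ (pℤ₍ₚ₎-neg ν∈pℤ))
                        (λ u₀∈ u₁∈ → ℤ₍ₚ₎-+ (pℤ₍ₚ₎⊆ℤ₍ₚ₎ u₀∈) (ℤ₍ₚ₎-* u₁∈ τ∈ℤ₍ₚ₎)) (y⊗pow k)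
    c⊗y⊗pow : ∀ c k → ιℤ c ⊗ (y ⊗ powK d y k) ∈ pℤ₍ₚ₎ ∔ ℤ₍ₚ₎ · y
    c⊗y⊗pow c k = ∔-scale (ι c) (pℤ₍ₚ₎-*ˡ (ℤ₍ₚ₎-ι c)) (ℤ₍ₚ₎-* (ℤ₍ₚ₎-ι c)) (y⊗pow k)
    step : ∀ c k {E} → E ∈ 1+pℤ₍ₚ₎ ∔ ℤ₍ₚ₎ · y → ιℤ c ⊗ (y ⊗ powK d y k) ⊕ (y ⊗ x) ⊗ E ∈ 1+pℤ₍ₚ₎ ∔ ℤ₍ₚ₎ · y
    step c k {E} E∈ = subst (λ F → ιℤ c ⊗ (y ⊗ powK d y k) ⊕ F ∈ 1+pℤ₍ₚ₎ ∔ ℤ₍ₚ₎ · y)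
      (sym (trans (cong (_⊗ E) y⊗x≡1) (⊗-identityˡ E)))
      (∔-⊕ pℤ₍ₚ₎-+-1+pℤ₍ₚ₎ ℤ₍ₚ₎-+ (c⊗y⊗pow c k) E∈)

  -- z² = z − ν with ν ∈ pℤ₍ₚ₎: z is idempotent modulo p, and s^(deg f) f(x) ≡ 1 or a unit multiple of z.
  idempotent-case : ∀ x s → pℤ₍ₚ₎ s → trace (ιℚ s ⊗ x) ≡ 1ℚ → pℤ₍ₚ₎ (norm (ιℚ s ⊗ x)) → IsIntegral d x →
    0K ∈ 1+pℤ₍ₚ₎ ∔ pℤ₍ₚ₎ · (ιℚ s ⊗ x) ⊎ 0K ∈ pℤ₍ₚ₎ ∔ 1+pℤ₍ₚ₎ · (ιℚ s ⊗ x)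
  idempotent-case x s s∈pℤ τ≡1 ν∈pℤ = integral⇒invariant-at-0 P (ιℚ s) x
    (inj₁ (1ℚ , 0ℚ , 1∈1+pℤ₍ₚ₎ , pℤ₍ₚ₎-0 , ιℚ≡lin 1ℚ z)) step
    where
    z : K
    z = ιℚ s ⊗ x
    P : K → Set
    P E = E ∈ 1+pℤ₍ₚ₎ ∔ pℤ₍ₚ₎ · z ⊎ E ∈ pℤ₍ₚ₎ ∔ 1+pℤ₍ₚ₎ · z
    u₀+u₁τ∈1+pℤ₍ₚ₎ : ∀ {u₀ u₁} → 1+pℤ₍ₚ₎ (u₀ ℚ.+ u₁) → 1+pℤ₍ₚ₎ (u₀ ℚ.+ u₁ ℚ.* trace z)
    u₀+u₁τ∈1+pℤ₍ₚ₎ {u₀} {u₁} = subst (λ t → 1+pℤ₍ₚ₎ (u₀ ℚ.+ t)) (trans (sym (ℚ.*-identityʳ u₁)) (cong (u₁ ℚ.*_) (sym τ≡1)))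
    z⊗ : ∀ {E} → P E → z ⊗ E ∈ pℤ₍ₚ₎ ∔ 1+pℤ₍ₚ₎ · z
    z⊗ (inj₁ E∈) = ∔-⊗ (λ _ u₁∈ → pℤ₍ₚ₎-*ʳ u₁∈ (pℤ₍ₚ₎⊆ℤ₍ₚ₎ (pℤ₍ₚ₎-neg ν∈pℤ)))
                       (λ {u₀} {u₁} u₀∈ u₁∈ → u₀+u₁τ∈1+pℤ₍ₚ₎ {u₀} {u₁} (1+pℤ₍ₚ₎-+-pℤ₍ₚ₎ u₀∈ u₁∈)) E∈
    z⊗ (inj₂ E∈) = ∔-⊗ (λ _ u₁∈ → pℤ₍ₚ₎-*ˡ (1+pℤ₍ₚ₎⊆ℤ₍ₚ₎ u₁∈) (pℤ₍ₚ₎-neg ν∈pℤ))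
                       (λ {u₀} {u₁} u₀∈ u₁∈ → u₀+u₁τ∈1+pℤ₍ₚ₎ {u₀} {u₁} (pℤ₍ₚ₎-+-1+pℤ₍ₚ₎ u₀∈ u₁∈)) E∈
    s⊗pow : ∀ k → Σ ℚ λ r → pℤ₍ₚ₎ r × ιℚ s ⊗ powK d (ιℚ s) k ≡ ιℚ r
    s⊗pow zero = s , s∈pℤ , trans (ιℚ-homo-* s 1ℚ) (cong ιℚ (ℚ.*-identityʳ s))
    s⊗pow (suc k) with s⊗pow k
    ... | r , r∈pℤ , eq = s ℚ.* r , pℤ₍ₚ₎-*ʳ s∈pℤ (pℤ₍ₚ₎⊆ℤ₍ₚ₎ r∈pℤ) , trans (cong (ιℚ s ⊗_) eq) (ιℚ-homo-* s r)
    c⊗s⊗pow : ∀ c k → ιℤ c ⊗ (ιℚ s ⊗ powK d (ιℚ s) k) ∈ pℤ₍ₚ₎ ∔ pℤ₍ₚ₎ · z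
    c⊗s⊗pow c k with s⊗pow k
    ... | r , r∈pℤ , eq = ι c ℚ.* r , 0ℚ , pℤ₍ₚ₎-*ˡ (ℤ₍ₚ₎-ι c) r∈pℤ , pℤ₍ₚ₎-0 ,
      trans (cong (ιℤ c ⊗_) eq) (trans (ιℚ-homo-* (ι c) r) (ιℚ≡lin (ι c ℚ.* r) z))
    step : ∀ c k {E} → P E → P (ιℤ c ⊗ (ιℚ s ⊗ powK d (ιℚ s) k) ⊕ z ⊗ E)
    step c k E∈ = inj₂ (∔-⊕ pℤ₍ₚ₎-+ pℤ₍ₚ₎-+-1+pℤ₍ₚ₎ (c⊗s⊗pow c k) (z⊗ E∈))

  0∉1+pℤ₍ₚ₎∔·w : ∀ {B w} → im w ≢ 0ℚ → ¬ 0K ∈ 1+pℤ₍ₚ₎ ∔ B · w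
  0∉1+pℤ₍ₚ₎∔·w {w = w} im≢0 (u₀ , u₁ , u₀∈ , _ , eq) = 0∉1+pℤ₍ₚ₎ (subst 1+pℤ₍ₚ₎ (proj₁ (lin≡0⇒≡0 {u₀} {u₁} {w} im≢0 eq)) u₀∈)

  0∉∔1+pℤ₍ₚ₎·w : ∀ {A w} → im w ≢ 0ℚ → ¬ 0K ∈ A ∔ 1+pℤ₍ₚ₎ · w
  0∉∔1+pℤ₍ₚ₎·w {w = w} im≢0 (u₀ , u₁ , _ , u₁∈ , eq) = 0∉1+pℤ₍ₚ₎ (subst 1+pℤ₍ₚ₎ (proj₂ (lin≡0⇒≡0 {u₀} {u₁} {w} im≢0 eq)) u₁∈)

  0∉1+pℤ₍ₚ₎∔ℤ₍ₚ₎·pℤ₍ₚ₎ : ∀ {r} → pℤ₍ₚ₎ r → ¬ 0K ∈ 1+pℤ₍ₚ₎ ∔ ℤ₍ₚ₎ · ιℚ r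
  0∉1+pℤ₍ₚ₎∔ℤ₍ₚ₎·pℤ₍ₚ₎ {r} r∈pℤ (u₀ , u₁ , 1+ u₀-1∈pℤ , u₁∈ , eq) =
    1∉pℤ₍ₚ₎ (subst pℤ₍ₚ₎ 1≡ (pℤ₍ₚ₎-+ (pℤ₍ₚ₎-neg u₀-1∈pℤ) (pℤ₍ₚ₎-neg (pℤ₍ₚ₎-*ˡ u₁∈ r∈pℤ))))
    where
    open ≡-Reasoning
    0≡u₀+u₁r : 0ℚ ≡ u₀ ℚ.+ u₁ ℚ.* r
    0≡u₀+u₁r = cong re (trans eq (lin-components u₀ u₁ (ιℚ r)))
    1≡ : ℚ.- (u₀ ℚ.- 1ℚ) ℚ.+ ℚ.- (u₁ ℚ.* r) ≡ 1ℚ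
    1≡ = begin
      ℚ.- (u₀ ℚ.- 1ℚ) ℚ.+ ℚ.- (u₁ ℚ.* r)  ≡⟨ solve 3 (λ u₀ u₁ r → :- (u₀ :- con 1ℚ) :+ :- (u₁ :* r) := con 1ℚ :- (u₀ :+ u₁ :* r)) refl u₀ u₁ r ⟩
      1ℚ ℚ.- (u₀ ℚ.+ u₁ ℚ.* r)            ≡⟨ cong (λ v → 1ℚ ℚ.- v) (sym 0≡u₀+u₁r) ⟩
      1ℚ ℚ.- 0ℚ                           ≡⟨ ℚ.+-identityʳ 1ℚ ⟩
      1ℚ                                  ∎

  rational-integral⇒ℤ₍ₚ₎ : ∀ x → im x ≡ 0ℚ → IsIntegral d x → ℤ₍ₚ₎ (re x)
  rational-integral⇒ℤ₍ₚ₎ x im≡0 x-integral with ℤ₍ₚ₎⊎Inverse∈pℤ₍ₚ₎ (re x)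
  ... | inj₁ a∈ℤ₍ₚ₎ = a∈ℤ₍ₚ₎
  ... | inj₂ (r , r∈pℤ , ar≡1) =
    ⊥-elim (0∉1+pℤ₍ₚ₎∔ℤ₍ₚ₎·pℤ₍ₚ₎ r∈pℤ (unit-case x (ιℚ r) r⊗x≡1 trace∈ℤ₍ₚ₎ norm∈pℤ x-integral))
    where
    r∈ℤ₍ₚ₎ : ℤ₍ₚ₎ r
    r∈ℤ₍ₚ₎ = pℤ₍ₚ₎⊆ℤ₍ₚ₎ r∈pℤ
    r⊗x≡1 : ιℚ r ⊗ x ≡ 1K
    r⊗x≡1 = trans (ιℚ-⊗ r x) (K-ext (trans (ℚ.*-comm r (re x)) ar≡1) (trans (cong (r ℚ.*_) im≡0) (ℚ.*-zeroʳ r)))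
    trace∈ℤ₍ₚ₎ : ℤ₍ₚ₎ (trace (ιℚ r))
    trace∈ℤ₍ₚ₎ = ℤ₍ₚ₎-+ r∈ℤ₍ₚ₎ r∈ℤ₍ₚ₎
    norm∈pℤ : pℤ₍ₚ₎ (norm (ιℚ r))
    norm∈pℤ = pℤ₍ₚ₎-+ (pℤ₍ₚ₎-*ʳ r∈pℤ r∈ℤ₍ₚ₎) (subst pℤ₍ₚ₎ (sym (ℚ.*-zeroʳ D)) pℤ₍ₚ₎-0)

  module _ (x : K) (im≢0 : im x ≢ 0ℚ) (x-integral : IsIntegral d x) where

    private
      scale≢0 : ∀ u c v → u ℚ.* c ≡ 1ℚ → v ≢ 0ℚ → c ℚ.* v ≢ 0ℚ
      scale≢0 u c v uc≡1 v≢0 cv≡0 = v≢0 (*≡0⇒≡0 v c≢0 cv≡0)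
        where
        c≢0 : c ≢ 0ℚ
        c≢0 refl with trans (sym uc≡1) (ℚ.*-zeroʳ u)
        ... | ()

    -- y = x⁻¹ = N⁻¹ x̄ has p-integral trace and norm in pℤ₍ₚ₎.
    norm-inverse-case : ∀ r → pℤ₍ₚ₎ r → norm x ℚ.* r ≡ 1ℚ → ¬ ℤ₍ₚ₎ (trace x ℚ.* r)
    norm-inverse-case r r∈pℤ Nr≡1 tr∈ℤ₍ₚ₎ =
      0∉1+pℤ₍ₚ₎∔·w im-y≢0 (unit-case x y y⊗x≡1 trace-y∈ℤ₍ₚ₎ norm-y∈pℤ x-integral)
      where
      open ≡-Reasoning
      y : K
      y = ιℚ r ⊗ conj x
      y⊗x≡1 : y ⊗ x ≡ 1K
      y⊗x≡1 = begin
        ιℚ r ⊗ conj x ⊗ x     ≡⟨ ⊗-assoc (ιℚ r) (conj x) x ⟩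
        ιℚ r ⊗ (conj x ⊗ x)   ≡⟨ cong (ιℚ r ⊗_) (conj-⊗ x) ⟩
        ιℚ r ⊗ ιℚ (norm x)    ≡⟨ ιℚ-homo-* r (norm x) ⟩
        ιℚ (r ℚ.* norm x)     ≡⟨ cong ιℚ (trans (ℚ.*-comm r (norm x)) Nr≡1) ⟩
        1K                    ∎
      trace-y∈ℤ₍ₚ₎ : ℤ₍ₚ₎ (trace y)
      trace-y∈ℤ₍ₚ₎ = subst ℤ₍ₚ₎ (sym (trans (trace-scale r (conj x)) (ℚ.*-comm r (trace x)))) tr∈ℤ₍ₚ₎
      norm-y≡r : norm y ≡ r
      norm-y≡r = begin
        norm y                  ≡⟨ trans (norm-scale r (conj x)) (cong (r ℚ.* r ℚ.*_) (norm-conj x)) ⟩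
        r ℚ.* r ℚ.* norm x      ≡⟨ solve 2 (λ r N → r :* r :* N := r :* (N :* r)) refl r (norm x) ⟩
        r ℚ.* (norm x ℚ.* r)    ≡⟨ cong (r ℚ.*_) Nr≡1 ⟩
        r ℚ.* 1ℚ                ≡⟨ ℚ.*-identityʳ r ⟩
        r                       ∎
      norm-y∈pℤ : pℤ₍ₚ₎ (norm y)
      norm-y∈pℤ = subst pℤ₍ₚ₎ (sym norm-y≡r) r∈pℤ
      im-y≢0 : im y ≢ 0ℚ
      im-y≢0 = subst (_≢ 0ℚ) (sym (cong im (ιℚ-⊗ r (conj x)))) (scale≢0 (norm x) r (ℚ.- im x) Nr≡1 (λ -b≡0 → im≢0 (ℚ.neg-injective -b≡0)))

    -- z = x / trace x has trace 1 and norm in pℤ₍ₚ₎.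
    trace-inverse-case : ∀ s → pℤ₍ₚ₎ s → trace x ℚ.* s ≡ 1ℚ → ¬ pℤ₍ₚ₎ (s ℚ.* s ℚ.* norm x)
    trace-inverse-case s s∈pℤ ts≡1 ν∈pℤ =
      [ 0∉1+pℤ₍ₚ₎∔·w im-z≢0 , 0∉∔1+pℤ₍ₚ₎·w im-z≢0 ]′ (idempotent-case x s s∈pℤ trace-z≡1 norm-z∈pℤ x-integral)
      where
      trace-z≡1 : trace (ιℚ s ⊗ x) ≡ 1ℚ
      trace-z≡1 = trans (trace-scale s x) (trans (ℚ.*-comm s (trace x)) ts≡1)
      norm-z∈pℤ : pℤ₍ₚ₎ (norm (ιℚ s ⊗ x))
      norm-z∈pℤ = subst pℤ₍ₚ₎ (sym (norm-scale s x)) ν∈pℤ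
      im-z≢0 : im (ιℚ s ⊗ x) ≢ 0ℚ
      im-z≢0 = subst (_≢ 0ℚ) (sym (cong im (ιℚ-⊗ s x))) (scale≢0 (trace x) s (im x) ts≡1 im≢0)

    -- If neither is p-integral, either t N⁻¹ is (unit case), or its inverse w lies in pℤ₍ₚ₎ and s² N = s w (idempotent case).
    irrational-integral⇒ℤ₍ₚ₎ : ℤ₍ₚ₎ (trace x) × ℤ₍ₚ₎ (norm x)
    irrational-integral⇒ℤ₍ₚ₎ with ℤ₍ₚ₎⊎Inverse∈pℤ₍ₚ₎ (trace x) | ℤ₍ₚ₎⊎Inverse∈pℤ₍ₚ₎ (norm x)
    ... | inj₁ t∈ℤ₍ₚ₎ | inj₁ N∈ℤ₍ₚ₎ = t∈ℤ₍ₚ₎ , N∈ℤ₍ₚ₎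
    ... | inj₁ t∈ℤ₍ₚ₎ | inj₂ (r , r∈pℤ , Nr≡1) =
      ⊥-elim (norm-inverse-case r r∈pℤ Nr≡1 (ℤ₍ₚ₎-* t∈ℤ₍ₚ₎ (pℤ₍ₚ₎⊆ℤ₍ₚ₎ r∈pℤ)))
    ... | inj₂ (s , s∈pℤ , ts≡1) | inj₁ N∈ℤ₍ₚ₎ =
      ⊥-elim (trace-inverse-case s s∈pℤ ts≡1 (pℤ₍ₚ₎-*ʳ (pℤ₍ₚ₎-*ʳ s∈pℤ (pℤ₍ₚ₎⊆ℤ₍ₚ₎ s∈pℤ)) N∈ℤ₍ₚ₎))
    ... | inj₂ (s , s∈pℤ , ts≡1) | inj₂ (r , r∈pℤ , Nr≡1) with ℤ₍ₚ₎⊎Inverse∈pℤ₍ₚ₎ (trace x ℚ.* r)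
    ...   | inj₁ tr∈ℤ₍ₚ₎ = ⊥-elim (norm-inverse-case r r∈pℤ Nr≡1 tr∈ℤ₍ₚ₎)
    ...   | inj₂ (w , w∈pℤ , trw≡1) =
      ⊥-elim (trace-inverse-case s s∈pℤ ts≡1 (subst pℤ₍ₚ₎ (sym s²N≡sw) (pℤ₍ₚ₎-*ʳ s∈pℤ (pℤ₍ₚ₎⊆ℤ₍ₚ₎ w∈pℤ))))
      where
      open ≡-Reasoning
      t : ℚ
      t = trace x
      N : ℚ
      N = norm x
      s²N≡sw : s ℚ.* s ℚ.* N ≡ s ℚ.* w
      s²N≡sw = begin
        s ℚ.* s ℚ.* N                         ≡⟨ sym (ℚ.*-identityʳ _) ⟩
        s ℚ.* s ℚ.* N ℚ.* 1ℚ                  ≡⟨ cong (s ℚ.* s ℚ.* N ℚ.*_) (sym trw≡1) ⟩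
        s ℚ.* s ℚ.* N ℚ.* (t ℚ.* r ℚ.* w)     ≡⟨ solve 5 (λ s N t r w → s :* s :* N :* (t :* r :* w) := (s :* w) :* ((t :* s) :* (N :* r))) refl s N t r w ⟩
        (s ℚ.* w) ℚ.* ((t ℚ.* s) ℚ.* (N ℚ.* r)) ≡⟨ cong₂ (λ u v → (s ℚ.* w) ℚ.* (u ℚ.* v)) ts≡1 Nr≡1 ⟩
        (s ℚ.* w) ℚ.* (1ℚ ℚ.* 1ℚ)             ≡⟨ ℚ.*-identityʳ _ ⟩
        s ℚ.* w                               ∎

  integral⇒ℤ₍ₚ₎-trace-norm : ∀ x → IsIntegral d x → ℤ₍ₚ₎ (trace x) × ℤ₍ₚ₎ (norm x)
  integral⇒ℤ₍ₚ₎-trace-norm x x-integral with im x ℚ.≟ 0ℚ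
  ... | no im≢0 = irrational-integral⇒ℤ₍ₚ₎ x im≢0 x-integral
  ... | yes im≡0 = ℤ₍ₚ₎-+ a∈ a∈ , ℤ₍ₚ₎-+ (ℤ₍ₚ₎-* a∈ a∈) (ℤ₍ₚ₎-* (ℤ₍ₚ₎-ι (+ d)) (ℤ₍ₚ₎-* b∈ b∈))
    where
    a∈ : ℤ₍ₚ₎ (re x)
    a∈ = rational-integral⇒ℤ₍ₚ₎ x im≡0 x-integral
    b∈ : ℤ₍ₚ₎ (im x)
    b∈ = subst ℤ₍ₚ₎ (sym im≡0) (ℤ₍ₚ₎-ι (+ 0))

module Integrality where
  open import Data.Rational.Base using (0ℚ)
  open import Data.Product.Base using (_×_; _,_; proj₁; proj₂)
  open import Relation.Binary.PropositionalEquality using (_≡_)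

  open Rationals
  open LocalToGlobal
  open QuadraticField using (trace; norm)
  open LocalIntegrality

  integral⇒integer-trace-norm : ∀ d x → IsIntegral d x → IsInteger (trace d x) × IsInteger (norm d x)
  integral⇒integer-trace-norm d x x-integral =
    locally-integer⇒integer _ (λ p p-prime → proj₁ (integral⇒ℤ₍ₚ₎-trace-norm d p p-prime x x-integral)) ,
    locally-integer⇒integer _ (λ p p-prime → proj₂ (integral⇒ℤ₍ₚ₎-trace-norm d p p-prime x x-integral))

  rational-integral⇒integer : ∀ d x → im x ≡ 0ℚ → IsIntegral d x → IsInteger (re x)
  rational-integral⇒integer d x im≡0 x-integral =
    locally-integer⇒integer (re x) (λ p p-prime → rational-integral⇒ℤ₍ₚ₎ d p p-prime x im≡0 x-integral)

module ThreeAdic where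
  open import Data.Nat.Base
  open import Data.Nat.Properties
  open import Data.Nat.Divisibility
  open import Data.Nat.DivMod using ([m+kn]%n≡m%n; m<n⇒m%n≡m)
  open import Data.Nat.Primality using (Prime; prime?; euclidsLemma; prime⇒irreducible)
  open import Data.Nat.Coprimality using (Coprime; coprime-divisor)
  open import Data.Nat.Induction using (<-wellFounded)
  open import Induction.WellFounded using (Acc; acc)
  open import Data.Product.Base using (Σ; _×_; _,_)
  open import Data.Sum.Base using (inj₁; inj₂)
  open import Data.Empty using (⊥-elim)
  open import Relation.Nullary using (¬_; yes; no)
  open import Relation.Nullary.Decidable using (from-yes; from-no)
  open import Relation.Binary.PropositionalEquality
  open import Data.Nat.Solver using (module +-*-Solver)
  open +-*-Solver

  3-prime : Prime 3
  3-prime = from-yes (prime? 3)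

  infix 9 _³
  _³ : ℕ → ℕ
  n ³ = n * n * n

  data Residue3 (n : ℕ) : Set where
    0mod3 : ∀ q → n ≡ 3 * q → Residue3 n
    1mod3 : ∀ q → n ≡ 3 * q + 1 → Residue3 n
    2mod3 : ∀ q → n ≡ 3 * q + 2 → Residue3 n

  residue3 : ∀ n → Residue3 n
  residue3 zero = 0mod3 0 refl
  residue3 (suc n) with residue3 n
  ... | 0mod3 q refl = 1mod3 q (+-comm 1 (3 * q))
  ... | 1mod3 q refl = 2mod3 q (solve 1 (λ q → con 1 :+ (con 3 :* q :+ con 1) := con 3 :* q :+ con 2) refl q)
  ... | 2mod3 q refl = 0mod3 (suc q) (solve 1 (λ q → con 1 :+ (con 3 :* q :+ con 2) := con 3 :* (con 1 :+ q)) refl q)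

  [3t+r]%3≡r : ∀ t r → r < 3 → (3 * t + r) % 3 ≡ r
  [3t+r]%3≡r t r r<3 = trans (cong (_% 3) (trans (+-comm (3 * t) r) (cong (r +_) (*-comm 3 t))))
                             (trans ([m+kn]%n≡m%n r t 3) (m<n⇒m%n≡m r<3))

  residue-unique : ∀ t s {r r′} → 3 * t + r ≡ 3 * s + r′ → r < 3 → r′ < 3 → r ≡ r′
  residue-unique t s {r} {r′} eq r<3 r′<3 =
    trans (sym ([3t+r]%3≡r t r r<3)) (trans (cong (_% 3) eq) ([3t+r]%3≡r s r′ r′<3))

  3∤1 : ¬ 3 ∣ 1
  3∤1 = from-no (3 ∣? 1)

  3∤2 : ¬ 3 ∣ 2
  3∤2 = from-no (3 ∣? 2)

  3∤3q+1 : ∀ q → ¬ 3 ∣ 3 * q + 1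
  3∤3q+1 q 3∣3q+1 = 3∤1 (∣m+n∣m⇒∣n 3∣3q+1 (m∣m*n q))

  3∤3q+2 : ∀ q → ¬ 3 ∣ 3 * q + 2
  3∤3q+2 q 3∣3q+2 = 3∤2 (∣m+n∣m⇒∣n 3∣3q+2 (m∣m*n q))

  3∤-* : ∀ {a b} → ¬ 3 ∣ a → ¬ 3 ∣ b → ¬ 3 ∣ a * b
  3∤-* {a} {b} 3∤a 3∤b 3∣ab with euclidsLemma a b 3-prime 3∣ab
  ... | inj₁ 3∣a = 3∤a 3∣a
  ... | inj₂ 3∣b = 3∤b 3∣b

  3∤-³ : ∀ {a} → ¬ 3 ∣ a → ¬ 3 ∣ a ³
  3∤-³ 3∤a = 3∤-* (3∤-* 3∤a 3∤a) 3∤a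

  3∤⇒coprime : ∀ {e} → ¬ 3 ∣ e → Coprime e 3
  3∤⇒coprime 3∤e (i∣e , i∣3) with prime⇒irreducible 3-prime i∣3
  ... | inj₁ i≡1 = i≡1
  ... | inj₂ refl = ⊥-elim (3∤e i∣e)

  3-adic-unique : ∀ a b {x y} → 3 ^ a * x ≡ 3 ^ b * y → ¬ 3 ∣ x → ¬ 3 ∣ y → a ≡ b × x ≡ y
  3-adic-unique zero zero {x} {y} eq _ _ = refl , trans (sym (+-identityʳ x)) (trans eq (+-identityʳ y))
  3-adic-unique (suc a) (suc b) {x} {y} eq 3∤x 3∤y
    with 3-adic-unique a b (*-cancelˡ-≡ _ _ 3 (trans (sym (*-assoc 3 (3 ^ a) x)) (trans eq (*-assoc 3 (3 ^ b) y)))) 3∤x 3∤y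
  ... | refl , x≡y = refl , x≡y
  3-adic-unique zero (suc b) {x} {y} eq 3∤x _ =
    ⊥-elim (3∤x (divides (3 ^ b * y) (trans (sym (+-identityʳ x)) (trans eq (trans (*-assoc 3 (3 ^ b) y) (*-comm 3 (3 ^ b * y)))))))
  3-adic-unique (suc a) zero {x} {y} eq _ 3∤y =
    ⊥-elim (3∤y (divides (3 ^ a * x) (trans (sym (+-identityʳ y)) (trans (sym eq) (trans (*-assoc 3 (3 ^ a) x) (*-comm 3 (3 ^ a * x)))))))

  3-adic-decomposition : ∀ n → n ≢ 0 → Σ ℕ λ v → Σ ℕ λ n′ → n ≡ 3 ^ v * n′ × ¬ 3 ∣ n′
  3-adic-decomposition n = go n (<-wellFounded n)
    where
    go : ∀ n → Acc _<_ n → n ≢ 0 → Σ ℕ λ v → Σ ℕ λ n′ → n ≡ 3 ^ v * n′ × ¬ 3 ∣ n′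
    go n (acc rec) n≢0 with 3 ∣? n
    ... | no 3∤n = 0 , n , sym (+-identityʳ n) , 3∤n
    ... | yes (divides q refl) with go q (rec (m<m*n q 3 {{q≢0}} (s≤s (s≤s z≤n)))) (≢-nonZero⁻¹ q {{q≢0}})
      where
      q≢0 : NonZero q
      q≢0 = ≢-nonZero λ { refl → n≢0 refl }
    ... | v , n′ , q≡3^vn′ , 3∤n′ = suc v , n′ , trans (*-comm q 3) (trans (cong (3 *_) q≡3^vn′) (sym (*-assoc 3 (3 ^ v) n′))) , 3∤n′

  ∣3^j⇒≡3^f : ∀ j {e} → e ∣ 3 ^ j → Σ ℕ λ f → e ≡ 3 ^ f
  ∣3^j⇒≡3^f zero e∣1 = 0 , ∣1⇒≡1 e∣1
  ∣3^j⇒≡3^f (suc j) {e} e∣3^j+1 with residue3 e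
  ... | 0mod3 q refl with ∣3^j⇒≡3^f j {q} (*-cancelˡ-∣ 3 e∣3^j+1)
  ...   | f , refl = suc f , refl
  ∣3^j⇒≡3^f (suc j) {e} e∣3^j+1 | 1mod3 q refl = ∣3^j⇒≡3^f j (coprime-divisor (3∤⇒coprime (3∤3q+1 q)) e∣3^j+1)
  ∣3^j⇒≡3^f (suc j) {e} e∣3^j+1 | 2mod3 q refl = ∣3^j⇒≡3^f j (coprime-divisor (3∤⇒coprime (3∤3q+2 q)) e∣3^j+1)

  ∣3^j∧3∤⇒≡1 : ∀ j {e} → e ∣ 3 ^ j → ¬ 3 ∣ e → e ≡ 1
  ∣3^j∧3∤⇒≡1 j e∣3^j 3∤e with ∣3^j⇒≡3^f j e∣3^j
  ... | zero , e≡1 = e≡1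
  ... | suc f , refl = ⊥-elim (3∤e (m∣m*n (3 ^ f)))

module Cubes where
  open import Data.Nat.Base
  open import Data.Nat.Properties
  open import Data.Nat.Divisibility using (_∣_; divides)
  open import Data.Product.Base using (_×_; _,_; proj₁)
  open import Data.Sum.Base using (inj₁; inj₂)
  open import Data.Empty using (⊥-elim)
  open import Relation.Binary.PropositionalEquality
  open import Data.Nat.Solver using (module +-*-Solver)
  open +-*-Solver

  open ThreeAdic

  ³-mono-≤ : ∀ {a b} → a ≤ b → a ³ ≤ b ³
  ³-mono-≤ a≤b = *-mono-≤ (*-mono-≤ a≤b a≤b) a≤b

  ³≡0⇒≡0 : ∀ n → n ³ ≡ 0 → n ≡ 0
  ³≡0⇒≡0 zero _ = refl

  3^[3v]≡[3^v]³ : ∀ v → 3 ^ (3 * v) ≡ (3 ^ v) ³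
  3^[3v]≡[3^v]³ v = begin
    3 ^ (3 * v)                 ≡⟨ cong (3 ^_) (solve 1 (λ v → con 3 :* v := v :+ v :+ v) refl v) ⟩
    3 ^ (v + v + v)             ≡⟨ ^-distribˡ-+-* 3 (v + v) v ⟩
    3 ^ (v + v) * 3 ^ v         ≡⟨ cong (_* 3 ^ v) (^-distribˡ-+-* 3 v v) ⟩
    3 ^ v * 3 ^ v * 3 ^ v       ∎
    where open ≡-Reasoning

  ³≢³+1 : ∀ x y → 1 ≤ y → x ³ ≢ y ³ + 1
  ³≢³+1 x y 1≤y x³≡y³+1 with ≤-<-connex x y
  ... | inj₁ x≤y = <-irrefl refl (≤-trans (s≤s (³-mono-≤ x≤y)) (≤-reflexive (trans (+-comm 1 (y ³)) (sym x³≡y³+1))))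
  ... | inj₂ y<x = <-irrefl refl (≤-trans (s≤s (≤-reflexive x³≡y³+1)) (≤-trans y³+1<[1+y]³ (³-mono-≤ y<x)))
    where
    open ≤-Reasoning
    y³+1<[1+y]³ : y ³ + 1 < (suc y) ³
    y³+1<[1+y]³ = begin-strict
      y ³ + 1                        <⟨ m<m+n (y ³ + 1) (≤-trans 1≤y (≤-trans (m≤m+n y (2 * y)) (m≤m+n (3 * y) (3 * y * y)))) ⟩
      y ³ + 1 + (3 * y + 3 * y * y)  ≡⟨ solve 1 (λ y → y :* y :* y :+ con 1 :+ (con 3 :* y :+ con 3 :* y :* y)
                                                     := (con 1 :+ y) :* (con 1 :+ y) :* (con 1 :+ y)) refl y ⟩
      (suc y) ³                      ∎

  private
    Q : ℕ → ℕ
    Q h = 3 * (h * h + h) + 1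

    Q∣3^j⇒≡0 : ∀ j h → Q h ∣ 3 ^ j → h ≡ 0
    Q∣3^j⇒≡0 j h Q∣3^j = Q≡1⇒≡0 h (∣3^j∧3∤⇒≡1 j Q∣3^j (3∤3q+1 (h * h + h)))
      where
      Q≡1⇒≡0 : ∀ h → Q h ≡ 1 → h ≡ 0
      Q≡1⇒≡0 zero _ = refl
      Q≡1⇒≡0 (suc h) Q≡1 with +-cancelʳ-≡ 1 (3 * (suc h * suc h + suc h)) 0 Q≡1
      ... | ()

  -- A cube that is 1 mod 3 is (3h + 1)³ = 9h Q(h) + 1, and Q(h) ≡ 1 (mod 3) divides a power of 3 only if it is 1.
  ³≢3^j+1 : ∀ j n → n ³ ≢ 3 ^ j + 1
  ³≢3^j+1 zero zero ()
  ³≢3^j+1 zero (suc zero) ()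
  ³≢3^j+1 zero (suc (suc n)) n³≡2 =
    <-irrefl refl (≤-trans (s≤s (s≤s (s≤s z≤n))) (≤-trans (³-mono-≤ {2} (s≤s (s≤s z≤n))) (≤-reflexive n³≡2)))
  ³≢3^j+1 (suc j) n n³≡3^j+1 with residue3 n
  ... | 0mod3 q refl = 0≢1+n (residue-unique (9 * q ³) (3 ^ j) (trans (sym n³-mod-3) n³≡3^j+1) (s≤s z≤n) (s≤s (s≤s z≤n)))
    where
    n³-mod-3 : (3 * q) ³ ≡ 3 * (9 * q ³) + 0
    n³-mod-3 = solve 1 (λ q → (con 3 :* q) :* (con 3 :* q) :* (con 3 :* q) := con 3 :* (con 9 :* (q :* q :* q)) :+ con 0) refl q
  ... | 2mod3 q refl = 1+n≢n (residue-unique (9 * q ³ + 18 * (q * q) + 12 * q + 2) (3 ^ j) (trans (sym n³-mod-3) n³≡3^j+1) (s≤s (s≤s (s≤s z≤n))) (s≤s (s≤s z≤n)))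
    where
    n³-mod-3 : (3 * q + 2) ³ ≡ 3 * (9 * q ³ + 18 * (q * q) + 12 * q + 2) + 2
    n³-mod-3 = solve 1 (λ q → (con 3 :* q :+ con 2) :* (con 3 :* q :+ con 2) :* (con 3 :* q :+ con 2)
                            := con 3 :* (con 9 :* (q :* q :* q) :+ con 18 :* (q :* q) :+ con 12 :* q :+ con 2) :+ con 2) refl q
  ... | 1mod3 h refl = ≢-nonZero⁻¹ (3 ^ suc j) {{m^n≢0 3 (suc j)}}
                         (trans 3^[1+j]≡9hQ (cong (λ h → 9 * h * Q h) (Q∣3^j⇒≡0 (suc j) h (divides (9 * h) 3^[1+j]≡9hQ))))
    where
    3^[1+j]≡9hQ : 3 ^ suc j ≡ 9 * h * Q h
    3^[1+j]≡9hQ = +-cancelʳ-≡ 1 _ _ (trans (sym n³≡3^j+1)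
      (solve 1 (λ h → (con 3 :* h :+ con 1) :* (con 3 :* h :+ con 1) :* (con 3 :* h :+ con 1)
                    := con 9 :* h :* (con 3 :* (h :* h :+ h) :+ con 1) :+ con 1) refl h))

  -- Dually (3h + 2)³ + 1 = 9 (h + 1) Q(h).
  ³+1≡3^[1+j]⇒ : ∀ j m → m ³ + 1 ≡ 3 ^ suc j → m ≡ 2 × j ≡ 1
  ³+1≡3^[1+j]⇒ j m m³+1≡3^[1+j] with residue3 m
  ... | 0mod3 q refl = ⊥-elim (1+n≢0 (residue-unique (9 * q ³) (3 ^ j) (trans (sym m³+1-mod-3) (trans m³+1≡3^[1+j] (sym (+-identityʳ (3 ^ suc j))))) (s≤s (s≤s z≤n)) (s≤s z≤n)))
    where
    m³+1-mod-3 : (3 * q) ³ + 1 ≡ 3 * (9 * q ³) + 1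
    m³+1-mod-3 = solve 1 (λ q → (con 3 :* q) :* (con 3 :* q) :* (con 3 :* q) :+ con 1 := con 3 :* (con 9 :* (q :* q :* q)) :+ con 1) refl q
  ... | 1mod3 q refl = ⊥-elim (1+n≢0 (residue-unique (9 * q ³ + 9 * (q * q) + 3 * q) (3 ^ j) (trans (sym m³+1-mod-3) (trans m³+1≡3^[1+j] (sym (+-identityʳ (3 ^ suc j))))) (s≤s (s≤s (s≤s z≤n))) (s≤s z≤n)))
    where
    m³+1-mod-3 : (3 * q + 1) ³ + 1 ≡ 3 * (9 * q ³ + 9 * (q * q) + 3 * q) + 2
    m³+1-mod-3 = solve 1 (λ q → (con 3 :* q :+ con 1) :* (con 3 :* q :+ con 1) :* (con 3 :* q :+ con 1) :+ con 1
                              := con 3 :* (con 9 :* (q :* q :* q) :+ con 9 :* (q :* q) :+ con 3 :* q) :+ con 2) refl q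
  ... | 2mod3 h refl = m≡2 , j≡1
    where
    m³+1≡9[h+1]Q : (3 * h + 2) ³ + 1 ≡ 9 * (h + 1) * Q h
    m³+1≡9[h+1]Q = solve 1 (λ h → (con 3 :* h :+ con 2) :* (con 3 :* h :+ con 2) :* (con 3 :* h :+ con 2) :+ con 1
                                := con 9 :* (h :+ con 1) :* (con 3 :* (h :* h :+ h) :+ con 1)) refl h
    m≡2 : 3 * h + 2 ≡ 2
    m≡2 = cong (λ h → 3 * h + 2) (Q∣3^j⇒≡0 (suc j) h (divides (9 * (h + 1)) (trans (sym m³+1≡3^[1+j]) m³+1≡9[h+1]Q)))
    3²≡3^[1+j] : 3 ^ 2 * 1 ≡ 3 ^ suc j * 1
    3²≡3^[1+j] = trans (cong (λ m → m ³ + 1) (sym m≡2)) (trans m³+1≡3^[1+j] (sym (*-identityʳ (3 ^ suc j))))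
    j≡1 : j ≡ 1
    j≡1 = suc-injective (sym (proj₁ (3-adic-unique 2 (suc j) 3²≡3^[1+j] 3∤1 3∤1)))

module CubeEquations where
  open import Data.Nat.Base
  open import Data.Nat.Properties
  open import Data.Nat.Divisibility using (_∣_; _∣0)
  open import Data.Product.Base using (Σ; _×_; _,_; proj₁; proj₂)
  open import Data.Sum.Base using (inj₁; inj₂)
  open import Data.Empty using (⊥-elim)
  open import Relation.Nullary using (¬_)
  open import Relation.Binary.PropositionalEquality
  open import Function.Base using (_∘_)
  open import Data.Nat.Solver using (module +-*-Solver)
  open +-*-Solver

  open ThreeAdic
  open Cubes

  X*3^[3l]≡n³*3^o⇒ : ∀ X l o n → ¬ 3 ∣ X → X * 3 ^ (3 * l) ≡ n ³ * 3 ^ o →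
    Σ ℕ λ v → Σ ℕ λ m → n ≡ 3 ^ v * m × 3 * l ≡ 3 * v + o × X ≡ m ³
  X*3^[3l]≡n³*3^o⇒ X l o n 3∤X eq with 3-adic-decomposition n n≢0
    where
    n≢0 : n ≢ 0
    n≢0 refl = 3∤X (subst (3 ∣_) (sym X≡0) (3 ∣0))
      where
      X≡0 : X ≡ 0
      X≡0 = m*n≡0⇒m≡0 X (3 ^ (3 * l)) {{m^n≢0 3 (3 * l)}} eq
  ... | v , m , refl , 3∤m = v , m , refl , proj₁ same , proj₂ same
    where
    same : 3 * l ≡ 3 * v + o × X ≡ m ³
    same = 3-adic-unique (3 * l) (3 * v + o) (trans (*-comm (3 ^ (3 * l)) X) (trans eq (begin
      (3 ^ v * m) ³ * 3 ^ o              ≡⟨ solve 3 (λ P m B → (P :* m) :* (P :* m) :* (P :* m) :* B := (P :* P :* P :* B) :* (m :* m :* m)) refl (3 ^ v) m (3 ^ o) ⟩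
      (3 ^ v) ³ * 3 ^ o * m ³            ≡⟨ cong (λ t → t * 3 ^ o * m ³) (sym (3^[3v]≡[3^v]³ v)) ⟩
      3 ^ (3 * v) * 3 ^ o * m ³          ≡⟨ cong (_* m ³) (sym (^-distribˡ-+-* 3 (3 * v) o)) ⟩
      3 ^ (3 * v + o) * m ³              ∎))) 3∤X (3∤-³ 3∤m)
      where open ≡-Reasoning

  3^o≡[3^[l∸v]]³ : ∀ l v o → 3 * l ≡ 3 * v + o → 3 ^ o ≡ (3 ^ (l ∸ v)) ³
  3^o≡[3^[l∸v]]³ l v o 3l≡3v+o = trans (cong (3 ^_) o≡3[l∸v]) (3^[3v]≡[3^v]³ (l ∸ v))
    where
    o≡3[l∸v] : o ≡ 3 * (l ∸ v)
    o≡3[l∸v] = trans (sym (m+n∸m≡n (3 * v) o)) (trans (cong (_∸ 3 * v) (sym 3l≡3v+o)) (sym (*-distribˡ-∸ 3 l v)))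

  3^[1+o]≡3w+3 : ∀ o → Σ ℕ λ w → 3 ^ suc o ≡ 3 * w + 3
  3^[1+o]≡3w+3 o with 3 ^ o | m^n>0 3 o
  ... | suc w | _ = w , solve 1 (λ w → con 3 :* (con 1 :+ w) := con 3 :* w :+ con 3) refl w

  3^[i+1+o]≡3^i*3^[1+o] : ∀ i o → 3 ^ suc (i + o) ≡ 3 ^ i * 3 ^ suc o
  3^[i+1+o]≡3^i*3^[1+o] i o = trans (cong (3 ^_) (sym (+-suc i o))) (^-distribˡ-+-* 3 i (suc o))

  private
    3∤3^j+1 : ∀ j → ¬ 3 ∣ 3 ^ j + 1
    3∤3^j+1 zero = 3∤2
    3∤3^j+1 (suc j) = 3∤3q+1 (3 ^ j)

    [3^j+1]*3^[3l]≢n³ : ∀ j l n → (3 ^ j + 1) * 3 ^ (3 * l) ≢ n ³ * 1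
    [3^j+1]*3^[3l]≢n³ j l n eq with X*3^[3l]≡n³*3^o⇒ (3 ^ j + 1) l 0 n (3∤3^j+1 j) eq
    ... | _ , m , _ , _ , X≡m³ = ³≢3^j+1 j m (sym X≡m³)

  [3^i+3^k]*3^[3l]≢n³*3^k : ∀ i k l n → (3 ^ i + 3 ^ k) * 3 ^ (3 * l) ≢ n ³ * 3 ^ k
  [3^i+3^k]*3^[3l]≢n³*3^k i k l n eq with compare i k
  ... | less .i o with X*3^[3l]≡n³*3^o⇒ (1 + B) l (suc o) n (3∤3q+1 (3 ^ o) ∘ subst (3 ∣_) (+-comm 1 B)) eq′
    where
    B : ℕ
    B = 3 ^ suc o
    eq′ : (1 + B) * 3 ^ (3 * l) ≡ n ³ * B
    eq′ = *-cancelˡ-≡ _ _ (3 ^ i) {{m^n≢0 3 i}} (begin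
      3 ^ i * ((1 + B) * 3 ^ (3 * l))          ≡⟨ solve 3 (λ A B T → A :* ((con 1 :+ B) :* T) := (A :+ A :* B) :* T) refl (3 ^ i) B (3 ^ (3 * l)) ⟩
      (3 ^ i + 3 ^ i * B) * 3 ^ (3 * l)        ≡⟨ cong (λ t → (3 ^ i + t) * 3 ^ (3 * l)) (sym (3^[i+1+o]≡3^i*3^[1+o] i o)) ⟩
      (3 ^ i + 3 ^ suc (i + o)) * 3 ^ (3 * l)  ≡⟨ eq ⟩
      n ³ * 3 ^ suc (i + o)                    ≡⟨ cong (n ³ *_) (3^[i+1+o]≡3^i*3^[1+o] i o) ⟩
      n ³ * (3 ^ i * B)                        ≡⟨ solve 3 (λ c A B → c :* (A :* B) := A :* (c :* B)) refl (n ³) (3 ^ i) B ⟩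
      3 ^ i * (n ³ * B)                        ∎)
      where open ≡-Reasoning
  ... | v , m , _ , 3l≡3v+o , 1+B≡m³ =
    ³≢³+1 m (3 ^ (l ∸ v)) (m^n>0 3 (l ∸ v)) (trans (sym 1+B≡m³) (trans (+-comm 1 (3 ^ suc o)) (cong (_+ 1) (3^o≡[3^[l∸v]]³ l v (suc o) 3l≡3v+o))))
  [3^i+3^k]*3^[3l]≢n³*3^k i k l n eq | equal .i = [3^j+1]*3^[3l]≢n³ 0 l n
    (*-cancelˡ-≡ _ _ (3 ^ i) {{m^n≢0 3 i}} (trans (solve 2 (λ A T → A :* ((con 1 :+ con 1) :* T) := (A :+ A) :* T) refl (3 ^ i) (3 ^ (3 * l)))
      (trans eq (solve 2 (λ c A → c :* A := A :* (c :* con 1)) refl (n ³) (3 ^ i)))))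
  [3^i+3^k]*3^[3l]≢n³*3^k i k l n eq | greater .k o = [3^j+1]*3^[3l]≢n³ (suc o) l n
    (*-cancelˡ-≡ _ _ (3 ^ k) {{m^n≢0 3 k}} (begin
      3 ^ k * ((B + 1) * 3 ^ (3 * l))          ≡⟨ solve 3 (λ A B T → A :* ((B :+ con 1) :* T) := (A :* B :+ A) :* T) refl (3 ^ k) B (3 ^ (3 * l)) ⟩
      (3 ^ k * B + 3 ^ k) * 3 ^ (3 * l)        ≡⟨ cong (λ t → (t + 3 ^ k) * 3 ^ (3 * l)) (sym (3^[i+1+o]≡3^i*3^[1+o] k o)) ⟩
      (3 ^ suc (k + o) + 3 ^ k) * 3 ^ (3 * l)  ≡⟨ eq ⟩
      n ³ * 3 ^ k                              ≡⟨ solve 2 (λ c A → c :* A := A :* (c :* con 1)) refl (n ³) (3 ^ k) ⟩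
      3 ^ k * (n ³ * 1)                        ∎))
    where
    open ≡-Reasoning
    B : ℕ
    B = 3 ^ suc o

  3^[1+o]*T≢T+n³*3^[1+o] : ∀ o l n → 3 ^ suc o * 3 ^ (3 * l) ≢ 3 ^ (3 * l) + n ³ * 3 ^ suc o
  3^[1+o]*T≢T+n³*3^[1+o] o l n eq with 3^[1+o]≡3w+3 o
  ... | w , B≡3w+3 with X*3^[3l]≡n³*3^o⇒ (3 * w + 2) l (suc o) n (3∤3q+2 w) [3w+2]*T≡n³*B
    where
    open ≡-Reasoning
    B : ℕ
    B = 3 ^ suc o
    T : ℕ
    T = 3 ^ (3 * l)
    [3w+2]*T≡n³*B : (3 * w + 2) * T ≡ n ³ * B
    [3w+2]*T≡n³*B = +-cancelˡ-≡ T _ _ (begin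
      T + (3 * w + 2) * T  ≡⟨ solve 2 (λ w T → T :+ (con 3 :* w :+ con 2) :* T := (con 3 :* w :+ con 3) :* T) refl w T ⟩
      (3 * w + 3) * T      ≡⟨ cong (_* T) (sym B≡3w+3) ⟩
      B * T                ≡⟨ eq ⟩
      T + n ³ * B          ∎)
  ...   | v , m , _ , 3l≡3v+o , 3w+2≡m³ = ³≢³+1 (3 ^ (l ∸ v)) m 1≤m (begin
      (3 ^ (l ∸ v)) ³  ≡⟨ sym (3^o≡[3^[l∸v]]³ l v (suc o) 3l≡3v+o) ⟩
      3 ^ suc o        ≡⟨ B≡3w+3 ⟩
      3 * w + 3        ≡⟨ +-assoc (3 * w) 2 1 ⟨
      3 * w + 2 + 1    ≡⟨ cong (_+ 1) 3w+2≡m³ ⟩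
      m ³ + 1          ∎)
    where
    open ≡-Reasoning
    1≤m : 1 ≤ m
    1≤m = n≢0⇒n>0 λ { refl → 3∤3q+2 w (subst (3 ∣_) (sym 3w+2≡m³) (3 ∣0)) }

  T+m³≡3^[1+o]*T⇒ : ∀ o l m → 3 ^ (3 * l) + m ³ ≡ 3 ^ suc o * 3 ^ (3 * l) → o ≡ 1 × m ≡ 3 ^ l * 2
  T+m³≡3^[1+o]*T⇒ o l m eq with 3^[1+o]≡3w+3 o
  ... | w , B≡3w+3 with X*3^[3l]≡n³*3^o⇒ (3 * w + 2) l 0 m (3∤3q+2 w) [3w+2]*T≡m³
    where
    open ≡-Reasoning
    T : ℕ
    T = 3 ^ (3 * l)
    [3w+2]*T≡m³ : (3 * w + 2) * T ≡ m ³ * 1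
    [3w+2]*T≡m³ = +-cancelˡ-≡ T _ _ (begin
      T + (3 * w + 2) * T  ≡⟨ solve 2 (λ w T → T :+ (con 3 :* w :+ con 2) :* T := (con 3 :* w :+ con 3) :* T) refl w T ⟩
      (3 * w + 3) * T      ≡⟨ cong (_* T) (sym B≡3w+3) ⟩
      3 ^ suc o * T        ≡⟨ eq ⟨
      T + m ³              ≡⟨ cong (T +_) (*-identityʳ (m ³)) ⟨
      T + m ³ * 1          ∎)
  ...   | v , m′ , refl , 3l≡3v , 3w+2≡m′³ with ³+1≡3^[1+j]⇒ o m′ m′³+1≡3^[1+o]
    where
    m′³+1≡3^[1+o] : m′ ³ + 1 ≡ 3 ^ suc o
    m′³+1≡3^[1+o] = trans (cong (_+ 1) (sym 3w+2≡m′³)) (trans (+-assoc (3 * w) 2 1) (sym B≡3w+3))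
  ...     | refl , refl = refl , cong (λ v → 3 ^ v * 2) (*-cancelˡ-≡ v l 3 (sym (trans 3l≡3v (+-identityʳ (3 * v)))))

  private
    3^k*T+m³*3^k≢3^i*T : ∀ i k l m → i ≤ k → 1 ≤ m → 3 ^ k * 3 ^ (3 * l) + m ³ * 3 ^ k ≢ 3 ^ i * 3 ^ (3 * l)
    3^k*T+m³*3^k≢3^i*T i k l m i≤k 1≤m eq = <-irrefl refl (≤-trans 3^i*T<lhs (≤-reflexive eq))
      where
      open ≤-Reasoning
      T : ℕ
      T = 3 ^ (3 * l)
      3^i*T<lhs : 3 ^ i * T < 3 ^ k * T + m ³ * 3 ^ k
      3^i*T<lhs = begin-strict
        3 ^ i * T                    ≤⟨ *-monoˡ-≤ T (^-monoʳ-≤ 3 i≤k) ⟩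
        3 ^ k * T                    <⟨ m<m+n (3 ^ k * T) (*-mono-≤ (³-mono-≤ 1≤m) (m^n>0 3 k)) ⟩
        3 ^ k * T + m ³ * 3 ^ k      ∎

  3^k*3^[3l]≡3^i*3^[3l]+n³*3^k⇒ : ∀ i k l n → 3 ^ k * 3 ^ (3 * l) ≡ 3 ^ i * 3 ^ (3 * l) + n ³ * 3 ^ k → i ≡ k × n ≡ 0
  3^k*3^[3l]≡3^i*3^[3l]+n³*3^k⇒ i k l n eq with compare i k
  ... | equal .i = refl , ³≡0⇒≡0 n (m*n≡0⇒m≡0 (n ³) (3 ^ i) {{m^n≢0 3 i}} n³*3^i≡0)
    where
    n³*3^i≡0 : n ³ * 3 ^ i ≡ 0
    n³*3^i≡0 = +-cancelˡ-≡ (3 ^ i * 3 ^ (3 * l)) (n ³ * 3 ^ i) 0 (trans (sym eq) (sym (+-identityʳ _)))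
  ... | greater .k o = ⊥-elim (<-irrefl refl (≤-trans 3^k*T<3^i*T (≤-trans (m≤m+n _ (n ³ * 3 ^ k)) (≤-reflexive (sym eq)))))
    where
    3^k*T<3^i*T : 3 ^ k * 3 ^ (3 * l) < 3 ^ suc (k + o) * 3 ^ (3 * l)
    3^k*T<3^i*T = *-monoˡ-< (3 ^ (3 * l)) {{m^n≢0 3 (3 * l)}} (^-monoʳ-< 3 (s≤s (s≤s z≤n)) (s≤s (m≤m+n k o)))
  ... | less .i o = ⊥-elim (3^[1+o]*T≢T+n³*3^[1+o] o l n (*-cancelˡ-≡ _ _ (3 ^ i) {{m^n≢0 3 i}} (begin
      3 ^ i * (B * T)                    ≡⟨ solve 3 (λ A B T → A :* (B :* T) := (A :* B) :* T) refl (3 ^ i) B T ⟩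
      3 ^ i * B * T                      ≡⟨ cong (_* T) (sym (3^[i+1+o]≡3^i*3^[1+o] i o)) ⟩
      3 ^ suc (i + o) * T                ≡⟨ eq ⟩
      3 ^ i * T + n ³ * 3 ^ suc (i + o)  ≡⟨ cong (λ t → 3 ^ i * T + n ³ * t) (3^[i+1+o]≡3^i*3^[1+o] i o) ⟩
      3 ^ i * T + n ³ * (3 ^ i * B)      ≡⟨ solve 4 (λ A T c B → A :* T :+ c :* (A :* B) := A :* (T :+ c :* B)) refl (3 ^ i) T (n ³) B ⟩
      3 ^ i * (T + n ³ * B)              ∎)))
    where
    open ≡-Reasoning
    B : ℕ
    B = 3 ^ suc o
    T : ℕ
    T = 3 ^ (3 * l)

  3^k*3^[3l]+m³*3^k≡3^i*3^[3l]⇒ : ∀ i k l m → 1 ≤ m → 3 ^ k * 3 ^ (3 * l) + m ³ * 3 ^ k ≡ 3 ^ i * 3 ^ (3 * l) →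
    i ≡ k + 2 × m ≡ 3 ^ l * 2
  3^k*3^[3l]+m³*3^k≡3^i*3^[3l]⇒ i k l m 1≤m eq with compare k i
  ... | less .k o with T+m³≡3^[1+o]*T⇒ o l m (*-cancelˡ-≡ _ _ (3 ^ k) {{m^n≢0 3 k}} (begin
      3 ^ k * (T + m ³)            ≡⟨ solve 3 (λ A T c → A :* (T :+ c) := A :* T :+ c :* A) refl (3 ^ k) T (m ³) ⟩
      3 ^ k * T + m ³ * 3 ^ k      ≡⟨ eq ⟩
      3 ^ suc (k + o) * T          ≡⟨ cong (_* T) (3^[i+1+o]≡3^i*3^[1+o] k o) ⟩
      3 ^ k * 3 ^ suc o * T        ≡⟨ *-assoc (3 ^ k) (3 ^ suc o) T ⟩
      3 ^ k * (3 ^ suc o * T)      ∎))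
    where
    open ≡-Reasoning
    T : ℕ
    T = 3 ^ (3 * l)
  ...   | refl , m≡3^l*2 = sym (+-suc k 1) , m≡3^l*2
  3^k*3^[3l]+m³*3^k≡3^i*3^[3l]⇒ i k l m 1≤m eq | equal .k = ⊥-elim (3^k*T+m³*3^k≢3^i*T i i l m ≤-refl 1≤m eq)
  3^k*3^[3l]+m³*3^k≡3^i*3^[3l]⇒ i k l m 1≤m eq | greater .i o = ⊥-elim (3^k*T+m³*3^k≢3^i*T i (suc (i + o)) l m (m≤n⇒m≤1+n (m≤m+n i o)) 1≤m eq)

module QuadraticForms where
  open import Data.Nat.Base
  open import Data.Nat.Properties
  open import Data.Nat.Divisibility using (_∣_; divides; n∣m⇒m%n≡0)
  open import Data.Product.Base using (Σ; _×_; _,_; proj₁)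
  open import Data.Sum.Base using (_⊎_; inj₁; inj₂; [_,_]′)
  open import Data.Empty using (⊥-elim)
  open import Relation.Nullary using (¬_; yes; no)
  open import Relation.Binary.PropositionalEquality
  open import Data.Nat.Solver using (module +-*-Solver)
  open +-*-Solver

  open ThreeAdic

  %3≡1⇒≡3e+1 : ∀ d → d % 3 ≡ 1 → Σ ℕ λ e → d ≡ 3 * e + 1
  %3≡1⇒≡3e+1 d d%3≡1 with residue3 d
  ... | 1mod3 e d≡3e+1 = e , d≡3e+1
  ... | 0mod3 q refl = ⊥-elim (0≢1+n (trans (sym (trans (cong (_% 3) (sym (+-identityʳ (3 * q)))) ([3t+r]%3≡r q 0 (s≤s z≤n)))) d%3≡1))
  ... | 2mod3 q refl = ⊥-elim (1+n≢n (trans (sym ([3t+r]%3≡r q 2 (s≤s (s≤s (s≤s z≤n))))) d%3≡1))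

  square-mod-3 : ∀ a → (Σ ℕ λ q → a ≡ 3 * q) ⊎ (Σ ℕ λ t → a * a ≡ 3 * t + 1)
  square-mod-3 a with residue3 a
  ... | 0mod3 q a≡3q = inj₁ (q , a≡3q)
  ... | 1mod3 q refl = inj₂ (3 * q * q + 2 * q , solve 1 (λ q → (con 3 :* q :+ con 1) :* (con 3 :* q :+ con 1)
                                                        := con 3 :* (con 3 :* q :* q :+ con 2 :* q) :+ con 1) refl q)
  ... | 2mod3 q refl = inj₂ (3 * q * q + 4 * q + 1 , solve 1 (λ q → (con 3 :* q :+ con 2) :* (con 3 :* q :+ con 2)
                                                            := con 3 :* (con 3 :* q :* q :+ con 4 :* q :+ con 1) :+ con 1) refl q)

  -- Modulo 3 the form is a² + b², and squares are 0 or 1.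
  3∣a²+db²⇒3∣a∧3∣b : ∀ {d e} a b X → d ≡ 3 * e + 1 → a * a + d * (b * b) ≡ 3 * X → Σ ℕ λ q → Σ ℕ λ r → a ≡ 3 * q × b ≡ 3 * r
  3∣a²+db²⇒3∣a∧3∣b {d} {e} a b X refl eq with square-mod-3 a | square-mod-3 b
  ... | inj₁ (q , a≡3q) | inj₁ (r , b≡3r) = q , r , a≡3q , b≡3r
  ... | inj₁ (q , refl) | inj₂ (t , b²≡3t+1) =
    ⊥-elim (1+n≢0 (residue-unique (3 * q * q + 3 * e * t + e + t) X (trans (sym form≡) (trans eq (sym (+-identityʳ (3 * X))))) (s≤s (s≤s z≤n)) (s≤s z≤n)))
    where
    form≡ : 3 * q * (3 * q) + (3 * e + 1) * (b * b) ≡ 3 * (3 * q * q + 3 * e * t + e + t) + 1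
    form≡ = trans (cong (λ s → 3 * q * (3 * q) + (3 * e + 1) * s) b²≡3t+1)
      (solve 3 (λ q e t → con 3 :* q :* (con 3 :* q) :+ (con 3 :* e :+ con 1) :* (con 3 :* t :+ con 1)
                        := con 3 :* (con 3 :* q :* q :+ con 3 :* e :* t :+ e :+ t) :+ con 1) refl q e t)
  ... | inj₂ (t , a²≡3t+1) | inj₁ (r , refl) =
    ⊥-elim (1+n≢0 (residue-unique (t + (3 * e + 1) * (3 * r * r)) X (trans (sym form≡) (trans eq (sym (+-identityʳ (3 * X))))) (s≤s (s≤s z≤n)) (s≤s z≤n)))
    where
    form≡ : a * a + (3 * e + 1) * (3 * r * (3 * r)) ≡ 3 * (t + (3 * e + 1) * (3 * r * r)) + 1
    form≡ = trans (cong (_+ (3 * e + 1) * (3 * r * (3 * r))) a²≡3t+1)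
      (solve 3 (λ t e r → con 3 :* t :+ con 1 :+ (con 3 :* e :+ con 1) :* (con 3 :* r :* (con 3 :* r))
                        := con 3 :* (t :+ (con 3 :* e :+ con 1) :* (con 3 :* r :* r)) :+ con 1) refl t e r)
  ... | inj₂ (t , a²≡3t+1) | inj₂ (s , b²≡3s+1) =
    ⊥-elim (1+n≢0 (residue-unique (t + 3 * e * s + e + s) X (trans (sym form≡) (trans eq (sym (+-identityʳ (3 * X))))) (s≤s (s≤s (s≤s z≤n))) (s≤s z≤n)))
    where
    form≡ : a * a + (3 * e + 1) * (b * b) ≡ 3 * (t + 3 * e * s + e + s) + 2
    form≡ = trans (cong₂ (λ x y → x + (3 * e + 1) * y) a²≡3t+1 b²≡3s+1)
      (solve 3 (λ t e s → con 3 :* t :+ con 1 :+ (con 3 :* e :+ con 1) :* (con 3 :* s :+ con 1)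
                        := con 3 :* (t :+ con 3 :* e :* s :+ e :+ s) :+ con 2) refl t e s)

  a²+db²≡4*3^f⇒b≡0 : ∀ {d e} → d ≡ 3 * e + 1 → 2 ≤ d → ¬ 2 * 2 ∣ d → ∀ f a b → a * a + d * (b * b) ≡ 4 * 3 ^ f → b ≡ 0
  a²+db²≡4*3^f⇒b≡0 _ _ _ zero a zero _ = refl
  a²+db²≡4*3^f⇒b≡0 {d} _ 2≤d _ zero a (suc (suc b)) eq = ⊥-elim (<-irrefl refl (≤-trans 5≤form (≤-reflexive eq)))
    where
    5≤form : 5 ≤ a * a + d * (suc (suc b) * suc (suc b))
    5≤form = ≤-trans (≤-trans (m≤n+m 5 3) (*-mono-≤ 2≤d (*-mono-≤ (s≤s (s≤s (z≤n {b}))) (s≤s (s≤s (z≤n {b})))))) (m≤n+m _ (a * a))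
  a²+db²≡4*3^f⇒b≡0 {d} _ _ 4∤d zero zero (suc zero) eq = ⊥-elim (4∤d (divides 1 (trans (sym (*-identityʳ d)) eq)))
  a²+db²≡4*3^f⇒b≡0 {d} {e} d≡3e+1 _ _ zero (suc zero) (suc zero) eq =
    ⊥-elim (1+n≢0 (residue-unique e 1 (trans (sym d≡3e+1) d≡3) (s≤s (s≤s z≤n)) (s≤s z≤n)))
    where
    d≡3 : d ≡ 3
    d≡3 = +-cancelˡ-≡ 1 d 3 (trans (cong suc (sym (*-identityʳ d))) eq)
  a²+db²≡4*3^f⇒b≡0 {d} _ 2≤d _ zero (suc (suc a)) (suc zero) eq = ⊥-elim (<-irrefl refl (≤-trans 5≤form (≤-reflexive eq)))
    where
    5≤form : 5 ≤ suc (suc a) * suc (suc a) + d * 1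
    5≤form = ≤-trans (s≤s (s≤s (s≤s (s≤s (s≤s z≤n)))))
      (+-mono-≤ (*-mono-≤ (s≤s (s≤s (z≤n {a}))) (s≤s (s≤s (z≤n {a})))) (≤-trans 2≤d (≤-reflexive (sym (*-identityʳ d)))))
  a²+db²≡4*3^f⇒b≡0 {d} {e} d≡3e+1 2≤d 4∤d (suc f) a b eq
    with 3∣a²+db²⇒3∣a∧3∣b {d} {e} a b (4 * 3 ^ f) d≡3e+1 (trans eq (solve 1 (λ P → con 4 :* (con 3 :* P) := con 3 :* (con 4 :* P)) refl (3 ^ f)))
  ... | q , r , refl , refl = cong (3 *_) (descend f 9[q²+dr²]≡4*3^[1+f])
    where
    9[q²+dr²]≡4*3^[1+f] : 9 * (q * q + d * (r * r)) ≡ 4 * 3 ^ suc f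
    9[q²+dr²]≡4*3^[1+f] = trans (solve 3 (λ q r d → con 9 :* (q :* q :+ d :* (r :* r)) := con 3 :* q :* (con 3 :* q) :+ d :* (con 3 :* r :* (con 3 :* r))) refl q r d) eq
    descend : ∀ f → 9 * (q * q + d * (r * r)) ≡ 4 * 3 ^ suc f → r ≡ 0
    descend zero eq′ = ⊥-elim (0≢1+n (residue-unique (q * q + d * (r * r)) 1 (trans (+-identityʳ _) 3X≡4) (s≤s z≤n) (s≤s (s≤s z≤n))))
      where
      3X≡4 : 3 * (q * q + d * (r * r)) ≡ 4
      3X≡4 = *-cancelˡ-≡ _ 4 3 (trans (solve 1 (λ X → con 3 :* (con 3 :* X) := con 9 :* X) refl (q * q + d * (r * r))) eq′)
    descend (suc f) eq′ = a²+db²≡4*3^f⇒b≡0 {d} {e} d≡3e+1 2≤d 4∤d f q r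
      (*-cancelˡ-≡ _ _ 9 (trans eq′ (solve 1 (λ P → con 4 :* (con 3 :* (con 3 :* P)) := con 9 :* (con 4 :* P)) refl (3 ^ f))))

  3a²≡db²⇒b≡0 : ∀ {d} → d % 3 ≡ 1 → ∀ a b → 3 * (a * a) ≡ d * (b * b) → b ≡ 0
  3a²≡db²⇒b≡0 {d} d%3≡1 a b eq with b ≟ 0
  ... | yes b≡0 = b≡0
  ... | no b≢0 with 3-adic-decomposition a a≢0 | 3-adic-decomposition b b≢0
    where
    a≢0 : a ≢ 0
    a≢0 refl with m*n≡0⇒m≡0∨n≡0 d (sym eq)
    ... | inj₁ refl = 0≢1+n d%3≡1
    ... | inj₂ b²≡0 = [ b≢0 , b≢0 ]′ (m*n≡0⇒m≡0∨n≡0 b b²≡0)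
  ... | u , a′ , refl , 3∤a′ | v , b′ , refl , 3∤b′ = ⊥-elim (even≢odd v u (sym (proj₁ same)))
    where
    open ≡-Reasoning
    3∤d : ¬ 3 ∣ d
    3∤d 3∣d = 0≢1+n (trans (sym (n∣m⇒m%n≡0 d 3 3∣d)) d%3≡1)
    3^[2w]≡3^w*3^w : ∀ w → 3 ^ (2 * w) ≡ 3 ^ w * 3 ^ w
    3^[2w]≡3^w*3^w w = trans (cong (3 ^_) (cong (w +_) (+-identityʳ w))) (^-distribˡ-+-* 3 w w)
    same : suc (2 * u) ≡ 2 * v × a′ * a′ ≡ d * (b′ * b′)
    same = 3-adic-unique (suc (2 * u)) (2 * v) (begin
      3 * 3 ^ (2 * u) * (a′ * a′)         ≡⟨ cong (λ t → 3 * t * (a′ * a′)) (3^[2w]≡3^w*3^w u) ⟩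
      3 * (3 ^ u * 3 ^ u) * (a′ * a′)     ≡⟨ solve 2 (λ A a → con 3 :* (A :* A) :* (a :* a) := con 3 :* (A :* a :* (A :* a))) refl (3 ^ u) a′ ⟩
      3 * (3 ^ u * a′ * (3 ^ u * a′))     ≡⟨ eq ⟩
      d * (3 ^ v * b′ * (3 ^ v * b′))     ≡⟨ solve 3 (λ d B b → d :* (B :* b :* (B :* b)) := B :* B :* (d :* (b :* b))) refl d (3 ^ v) b′ ⟩
      3 ^ v * 3 ^ v * (d * (b′ * b′))     ≡⟨ cong (_* (d * (b′ * b′))) (3^[2w]≡3^w*3^w v) ⟨
      3 ^ (2 * v) * (d * (b′ * b′))       ∎) (3∤-* 3∤a′ 3∤a′) (3∤-* 3∤d (3∤-* 3∤b′ 3∤b′))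

module IntegerEquations where
  open import Data.Nat.Base as ℕ using (ℕ; zero; suc; _≤_; _%_)
  import Data.Nat.Properties as ℕ
  open import Data.Nat.Divisibility using (_∣_; divides)
  open import Data.Integer.Base as ℤ using (ℤ; +_; -[1+_])
  import Data.Integer.Properties as ℤ
  open import Data.Product.Base using (Σ; _×_; _,_)
  open import Data.Sum.Base using (_⊎_; inj₁; inj₂)
  open import Data.Empty using (⊥-elim)
  open import Relation.Nullary using (¬_)
  open import Relation.Binary.PropositionalEquality
  open import Data.Integer.Solver using (module +-*-Solver)
  open +-*-Solver

  open ThreeAdic
  open Cubes
  open CubeEquations
  open QuadraticForms

  i*i≡+∣i∣² : ∀ i → i ℤ.* i ≡ + (ℤ.∣ i ∣ ℕ.* ℤ.∣ i ∣)
  i*i≡+∣i∣² (+ n) = sym (ℤ.pos-* n n)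
  i*i≡+∣i∣² -[1+ n ] = refl

  +[n³]≡[+n]³ : ∀ n → + (n ³) ≡ + n ℤ.* + n ℤ.* + n
  +[n³]≡[+n]³ n = trans (ℤ.pos-* (n ℕ.* n) n) (cong (ℤ._* + n) (ℤ.pos-* n n))

  i*j≡3^k⇒∣i∣≡3^f : ∀ i j k → i ℤ.* j ≡ + (3 ℕ.^ k) → Σ ℕ λ f → ℤ.∣ i ∣ ≡ 3 ℕ.^ f
  i*j≡3^k⇒∣i∣≡3^f i j k ij≡3^k = ∣3^j⇒≡3^f k {ℤ.∣ i ∣} (divides ℤ.∣ j ∣ 3^k≡∣j∣*∣i∣)
    where
    3^k≡∣j∣*∣i∣ : 3 ℕ.^ k ≡ ℤ.∣ j ∣ ℕ.* ℤ.∣ i ∣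
    3^k≡∣j∣*∣i∣ = trans (cong ℤ.∣_∣ (sym ij≡3^k)) (trans (ℤ.abs-* i j) (ℕ.*-comm ℤ.∣ i ∣ ℤ.∣ j ∣))

  i*j≡3^k⇒i≡±3^f : ∀ i j k → i ℤ.* j ≡ + (3 ℕ.^ k) → Σ ℕ λ f → i ≡ + (3 ℕ.^ f) ⊎ i ≡ ℤ.- + (3 ℕ.^ f)
  i*j≡3^k⇒i≡±3^f i j k ij≡3^k with i*j≡3^k⇒∣i∣≡3^f i j k ij≡3^k
  ... | f , ∣i∣≡3^f with i
  ...   | + n = f , inj₁ (cong +_ ∣i∣≡3^f)
  ...   | -[1+ n ] = f , inj₂ (cong (λ m → ℤ.- + m) ∣i∣≡3^f)

  ∣a²+db²∣ : ∀ d a b → ℤ.∣ a ℤ.* a ℤ.+ + d ℤ.* (b ℤ.* b) ∣ ≡ ℤ.∣ a ∣ ℕ.* ℤ.∣ a ∣ ℕ.+ d ℕ.* (ℤ.∣ b ∣ ℕ.* ℤ.∣ b ∣)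
  ∣a²+db²∣ d a b = cong ℤ.∣_∣ (begin
    a ℤ.* a ℤ.+ + d ℤ.* (b ℤ.* b)                             ≡⟨ cong₂ (λ u v → u ℤ.+ + d ℤ.* v) (i*i≡+∣i∣² a) (i*i≡+∣i∣² b) ⟩
    + (ℤ.∣ a ∣ ℕ.* ℤ.∣ a ∣) ℤ.+ + d ℤ.* + (ℤ.∣ b ∣ ℕ.* ℤ.∣ b ∣) ≡⟨ cong (λ v → + (ℤ.∣ a ∣ ℕ.* ℤ.∣ a ∣) ℤ.+ v) (sym (ℤ.pos-* d (ℤ.∣ b ∣ ℕ.* ℤ.∣ b ∣))) ⟩
    + (ℤ.∣ a ∣ ℕ.* ℤ.∣ a ∣) ℤ.+ + (d ℕ.* (ℤ.∣ b ∣ ℕ.* ℤ.∣ b ∣)) ≡⟨ sym (ℤ.pos-+ (ℤ.∣ a ∣ ℕ.* ℤ.∣ a ∣) (d ℕ.* (ℤ.∣ b ∣ ℕ.* ℤ.∣ b ∣))) ⟩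
    + (ℤ.∣ a ∣ ℕ.* ℤ.∣ a ∣ ℕ.+ d ℕ.* (ℤ.∣ b ∣ ℕ.* ℤ.∣ b ∣))   ∎)
    where open ≡-Reasoning

  a²+db²≡4n∧n∣3^k⇒b≡0 : ∀ {d} → d % 3 ≡ 1 → 2 ≤ d → ¬ 2 ℕ.* 2 ∣ d → ∀ a b n n′ k →
    a ℤ.* a ℤ.+ + d ℤ.* (b ℤ.* b) ≡ + 4 ℤ.* n → n ℤ.* n′ ≡ + (3 ℕ.^ k) → b ≡ + 0
  a²+db²≡4n∧n∣3^k⇒b≡0 {d} d%3≡1 2≤d 4∤d a b n n′ k form≡4n nn′≡3^k
    with %3≡1⇒≡3e+1 d d%3≡1 | i*j≡3^k⇒∣i∣≡3^f n n′ k nn′≡3^k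
  ... | e , d≡3e+1 | f , ∣n∣≡3^f = ℤ.∣i∣≡0⇒i≡0 (a²+db²≡4*3^f⇒b≡0 {d} {e} d≡3e+1 2≤d 4∤d f ℤ.∣ a ∣ ℤ.∣ b ∣ (begin
    ℤ.∣ a ∣ ℕ.* ℤ.∣ a ∣ ℕ.+ d ℕ.* (ℤ.∣ b ∣ ℕ.* ℤ.∣ b ∣) ≡⟨ sym (∣a²+db²∣ d a b) ⟩
    ℤ.∣ a ℤ.* a ℤ.+ + d ℤ.* (b ℤ.* b) ∣                 ≡⟨ cong ℤ.∣_∣ form≡4n ⟩
    ℤ.∣ + 4 ℤ.* n ∣                                      ≡⟨ ℤ.abs-* (+ 4) n ⟩
    4 ℕ.* ℤ.∣ n ∣                                        ≡⟨ cong (4 ℕ.*_) ∣n∣≡3^f ⟩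
    4 ℕ.* 3 ℕ.^ f                                        ∎))
    where open ≡-Reasoning

  3a²≡db²⇒b≡0ℤ : ∀ {d} → d % 3 ≡ 1 → ∀ a b → + 3 ℤ.* (a ℤ.* a) ≡ + d ℤ.* (b ℤ.* b) → b ≡ + 0
  3a²≡db²⇒b≡0ℤ {d} d%3≡1 a b eq = ℤ.∣i∣≡0⇒i≡0 (3a²≡db²⇒b≡0 {d} d%3≡1 ℤ.∣ a ∣ ℤ.∣ b ∣ (ℤ.+-injective (begin
    + (3 ℕ.* (ℤ.∣ a ∣ ℕ.* ℤ.∣ a ∣))   ≡⟨ trans (ℤ.pos-* 3 (ℤ.∣ a ∣ ℕ.* ℤ.∣ a ∣)) (cong (+ 3 ℤ.*_) (sym (i*i≡+∣i∣² a))) ⟩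
    + 3 ℤ.* (a ℤ.* a)                 ≡⟨ eq ⟩
    + d ℤ.* (b ℤ.* b)                 ≡⟨ trans (cong (+ d ℤ.*_) (i*i≡+∣i∣² b)) (sym (ℤ.pos-* d (ℤ.∣ b ∣ ℕ.* ℤ.∣ b ∣))) ⟩
    + (d ℕ.* (ℤ.∣ b ∣ ℕ.* ℤ.∣ b ∣))   ∎)))
    where open ≡-Reasoning

  private
    +a≢-+b : ∀ a b → b ≢ 0 → + a ≢ ℤ.- + b
    +a≢-+b a zero b≢0 _ = b≢0 refl

    +[[a+b]*c]≡ : ∀ a b c → + ((a ℕ.+ b) ℕ.* c) ≡ (+ a ℤ.+ + b) ℤ.* + c
    +[[a+b]*c]≡ a b c = trans (ℤ.pos-* (a ℕ.+ b) c) (cong (ℤ._* + c) (ℤ.pos-+ a b))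

    +[n³*k]≡ : ∀ n k → + (n ³ ℕ.* k) ≡ + n ℤ.* + n ℤ.* + n ℤ.* + k
    +[n³*k]≡ n k = trans (ℤ.pos-* (n ³) k) (cong (ℤ._* + k) (+[n³]≡[+n]³ n))

  ±3^i+3^k-cube : ∀ i k l U G → U ≡ + (3 ℕ.^ i) ⊎ U ≡ ℤ.- + (3 ℕ.^ i) →
    (U ℤ.+ + (3 ℕ.^ k)) ℤ.* + (3 ℕ.^ (3 ℕ.* l)) ≡ G ℤ.* G ℤ.* G ℤ.* + (3 ℕ.^ k) →
    U ≡ ℤ.- + (3 ℕ.^ k) × G ≡ + 0 ⊎ U ≡ ℤ.- + (3 ℕ.^ (k ℕ.+ 2)) × G ≡ ℤ.- + (3 ℕ.^ l ℕ.* 2)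
  ±3^i+3^k-cube i k l U (+ n) (inj₁ refl) eq = ⊥-elim ([3^i+3^k]*3^[3l]≢n³*3^k i k l n (ℤ.+-injective (begin
    + ((3 ℕ.^ i ℕ.+ 3 ℕ.^ k) ℕ.* 3 ℕ.^ (3 ℕ.* l))         ≡⟨ +[[a+b]*c]≡ (3 ℕ.^ i) (3 ℕ.^ k) (3 ℕ.^ (3 ℕ.* l)) ⟩
    (+ (3 ℕ.^ i) ℤ.+ + (3 ℕ.^ k)) ℤ.* + (3 ℕ.^ (3 ℕ.* l))  ≡⟨ eq ⟩
    + n ℤ.* + n ℤ.* + n ℤ.* + (3 ℕ.^ k)                   ≡⟨ +[n³*k]≡ n (3 ℕ.^ k) ⟨
    + (n ³ ℕ.* 3 ℕ.^ k)                                   ∎)))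
    where open ≡-Reasoning
  ±3^i+3^k-cube i k l U -[1+ n ] (inj₁ refl) eq = ⊥-elim (+a≢-+b ((3 ℕ.^ i ℕ.+ 3 ℕ.^ k) ℕ.* 3 ℕ.^ (3 ℕ.* l)) (n′ ³ ℕ.* 3 ℕ.^ k) n′³*3^k≢0 (begin
    + ((3 ℕ.^ i ℕ.+ 3 ℕ.^ k) ℕ.* 3 ℕ.^ (3 ℕ.* l))         ≡⟨ +[[a+b]*c]≡ (3 ℕ.^ i) (3 ℕ.^ k) (3 ℕ.^ (3 ℕ.* l)) ⟩
    (+ (3 ℕ.^ i) ℤ.+ + (3 ℕ.^ k)) ℤ.* + (3 ℕ.^ (3 ℕ.* l))  ≡⟨ eq ⟩
    ℤ.- + n′ ℤ.* ℤ.- + n′ ℤ.* ℤ.- + n′ ℤ.* + (3 ℕ.^ k)    ≡⟨ solve 2 (λ x K → :- x :* :- x :* :- x :* K := :- (x :* x :* x :* K)) refl (+ n′) (+ (3 ℕ.^ k)) ⟩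
    ℤ.- (+ n′ ℤ.* + n′ ℤ.* + n′ ℤ.* + (3 ℕ.^ k))          ≡⟨ cong ℤ.-_ (+[n³*k]≡ n′ (3 ℕ.^ k)) ⟨
    ℤ.- + (n′ ³ ℕ.* 3 ℕ.^ k)                              ∎))
    where
    open ≡-Reasoning
    n′ : ℕ
    n′ = suc n
    n′³*3^k≢0 : n′ ³ ℕ.* 3 ℕ.^ k ≢ 0
    n′³*3^k≢0 = ℕ.≢-nonZero⁻¹ (n′ ³ ℕ.* 3 ℕ.^ k) {{ℕ.m*n≢0 (n′ ³) (3 ℕ.^ k) {{ℕ.m*n≢0 (n′ ℕ.* n′) n′}} {{ℕ.m^n≢0 3 k}}}}
  ±3^i+3^k-cube i k l U (+ n) (inj₂ refl) eq with 3^k*3^[3l]≡3^i*3^[3l]+n³*3^k⇒ i k l n (ℤ.+-injective (begin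
    + (3 ℕ.^ k ℕ.* T)                                 ≡⟨ ℤ.pos-* (3 ℕ.^ k) T ⟩
    + (3 ℕ.^ k) ℤ.* + T                               ≡⟨ solve 3 (λ P K T → K :* T := (:- P :+ K) :* T :+ P :* T) refl (+ (3 ℕ.^ i)) (+ (3 ℕ.^ k)) (+ T) ⟩
    (ℤ.- + (3 ℕ.^ i) ℤ.+ + (3 ℕ.^ k)) ℤ.* + T ℤ.+ + (3 ℕ.^ i) ℤ.* + T ≡⟨ cong (ℤ._+ + (3 ℕ.^ i) ℤ.* + T) eq ⟩
    + n ℤ.* + n ℤ.* + n ℤ.* + (3 ℕ.^ k) ℤ.+ + (3 ℕ.^ i) ℤ.* + T ≡⟨ ℤ.+-comm (+ n ℤ.* + n ℤ.* + n ℤ.* + (3 ℕ.^ k)) (+ (3 ℕ.^ i) ℤ.* + T) ⟩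
    + (3 ℕ.^ i) ℤ.* + T ℤ.+ + n ℤ.* + n ℤ.* + n ℤ.* + (3 ℕ.^ k) ≡⟨ cong₂ ℤ._+_ (ℤ.pos-* (3 ℕ.^ i) T) (+[n³*k]≡ n (3 ℕ.^ k)) ⟨
    + (3 ℕ.^ i ℕ.* T) ℤ.+ + (n ³ ℕ.* 3 ℕ.^ k)          ≡⟨ ℤ.pos-+ (3 ℕ.^ i ℕ.* T) (n ³ ℕ.* 3 ℕ.^ k) ⟨
    + (3 ℕ.^ i ℕ.* T ℕ.+ n ³ ℕ.* 3 ℕ.^ k)              ∎))
    where
    open ≡-Reasoning
    T : ℕ
    T = 3 ℕ.^ (3 ℕ.* l)
  ... | refl , refl = inj₁ (refl , refl)
  ±3^i+3^k-cube i k l U -[1+ n ] (inj₂ refl) eq with 3^k*3^[3l]+m³*3^k≡3^i*3^[3l]⇒ i k l (suc n) (ℕ.s≤s ℕ.z≤n) (ℤ.+-injective (begin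
    + (3 ℕ.^ k ℕ.* T ℕ.+ m ³ ℕ.* 3 ℕ.^ k)                 ≡⟨ trans (ℤ.pos-+ (3 ℕ.^ k ℕ.* T) (m ³ ℕ.* 3 ℕ.^ k)) (cong₂ ℤ._+_ (ℤ.pos-* (3 ℕ.^ k) T) (+[n³*k]≡ m (3 ℕ.^ k))) ⟩
    + (3 ℕ.^ k) ℤ.* + T ℤ.+ + m ℤ.* + m ℤ.* + m ℤ.* + (3 ℕ.^ k)
        ≡⟨ solve 4 (λ P K T x → K :* T :+ x :* x :* x :* K := ((:- P :+ K) :* T :- (:- x :* :- x :* :- x :* K)) :+ P :* T) refl (+ (3 ℕ.^ i)) (+ (3 ℕ.^ k)) (+ T) (+ m) ⟩
    ((ℤ.- + (3 ℕ.^ i) ℤ.+ + (3 ℕ.^ k)) ℤ.* + T ℤ.- ℤ.- + m ℤ.* ℤ.- + m ℤ.* ℤ.- + m ℤ.* + (3 ℕ.^ k)) ℤ.+ + (3 ℕ.^ i) ℤ.* + T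
        ≡⟨ cong (λ t → (t ℤ.- ℤ.- + m ℤ.* ℤ.- + m ℤ.* ℤ.- + m ℤ.* + (3 ℕ.^ k)) ℤ.+ + (3 ℕ.^ i) ℤ.* + T) eq ⟩
    (G³K ℤ.- G³K) ℤ.+ + (3 ℕ.^ i) ℤ.* + T                  ≡⟨ solve 2 (λ g P → (g :- g) :+ P := P) refl G³K (+ (3 ℕ.^ i) ℤ.* + T) ⟩
    + (3 ℕ.^ i) ℤ.* + T                                   ≡⟨ ℤ.pos-* (3 ℕ.^ i) T ⟨
    + (3 ℕ.^ i ℕ.* T)                                     ∎))
    where
    open ≡-Reasoning
    T : ℕ
    T = 3 ℕ.^ (3 ℕ.* l)
    m : ℕ
    m = suc n
    G³K : ℤ
    G³K = ℤ.- + m ℤ.* ℤ.- + m ℤ.* ℤ.- + m ℤ.* + (3 ℕ.^ k)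
  ... | refl , m≡3^l*2 = inj₂ (refl , cong (λ x → ℤ.- + x) m≡3^l*2)

module PowersOfThree where
  open import Data.Nat.Base as ℕ using (ℕ)
  import Data.Nat.Properties as ℕ
  open import Data.Integer.Base as ℤ using (ℤ; +_; -[1+_])
  import Data.Integer.Properties as ℤ
  open import Data.Rational.Base as ℚ using (ℚ; 0ℚ; 1ℚ)
  open import Data.Product.Base using (Σ; _×_; _,_)
  open import Data.Sum.Base using (_⊎_; inj₁; inj₂)
  open import Relation.Binary.PropositionalEquality
  open import Data.Rational.Solver using (module +-*-Solver)
  open +-*-Solver

  open Rationals
  open Cubes using (3^[3v]≡[3^v]³)
  open IntegerEquations using (±3^i+3^k-cube)

  pow3 : ℕ → ℚ
  pow3 k = ι (+ (3 ℕ.^ k))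

  pow3-+ : ∀ k m → pow3 (k ℕ.+ m) ≡ pow3 k ℚ.* pow3 m
  pow3-+ k m = trans (cong (λ n → ι (+ n)) (ℕ.^-distribˡ-+-* 3 k m))
    (trans (cong ι (ℤ.pos-* (3 ℕ.^ k) (3 ℕ.^ m))) (ι-homo-* (+ (3 ℕ.^ k)) (+ (3 ℕ.^ m))))

  pow3≢0 : ∀ k → pow3 k ≢ 0ℚ
  pow3≢0 k = ι-nonZero λ 3^k≡0 → ℕ.≢-nonZero⁻¹ (3 ℕ.^ k) {{ℕ.m^n≢0 3 k}} (ℤ.+-injective 3^k≡0)

  -[3^k*n]≡3^k*-n : ∀ k n → ℤ.- + (3 ℕ.^ k ℕ.* n) ≡ + (3 ℕ.^ k) ℤ.* ℤ.- + n
  -[3^k*n]≡3^k*-n k n = trans (cong ℤ.-_ (ℤ.pos-* (3 ℕ.^ k) n)) (ℤ.neg-distribʳ-* (+ (3 ℕ.^ k)) (+ n))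

  pow3-cancel : ∀ k {q} z → pow3 k ℚ.* q ≡ ι (+ (3 ℕ.^ k) ℤ.* z) → q ≡ ι z
  pow3-cancel k {q} z eq = *-cancelˡ-≡ q (ι z) (pow3≢0 k) (trans eq (ι-homo-* (+ (3 ℕ.^ k)) z))

  pow3[3l]≡pow3[l]³ : ∀ l → pow3 (3 ℕ.* l) ≡ pow3 l ℚ.* pow3 l ℚ.* pow3 l
  pow3[3l]≡pow3[l]³ l = trans (cong (λ n → ι (+ n)) (3^[3v]≡[3^v]³ l))
    (trans (cong ι (ℤ.pos-* (3 ℕ.^ l ℕ.* 3 ℕ.^ l) (3 ℕ.^ l)))
    (trans (ι-homo-* (+ (3 ℕ.^ l ℕ.* 3 ℕ.^ l)) (+ (3 ℕ.^ l)))
    (cong (ℚ._* pow3 l) (trans (cong ι (ℤ.pos-* (3 ℕ.^ l) (3 ℕ.^ l))) (ι-homo-* (+ (3 ℕ.^ l)) (+ (3 ℕ.^ l)))))))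

  cleared-equation : ∀ k l U G {a g} → pow3 k ℚ.* a ≡ ι U → pow3 l ℚ.* g ≡ ι G → a ℚ.+ 1ℚ ≡ g ℚ.* g ℚ.* g →
    (U ℤ.+ + (3 ℕ.^ k)) ℤ.* + (3 ℕ.^ (3 ℕ.* l)) ≡ G ℤ.* G ℤ.* G ℤ.* + (3 ℕ.^ k)
  cleared-equation k l U G {a} {g} c*a≡U C*g≡G a+1≡g³ = ι-injective (begin
    ι ((U ℤ.+ + (3 ℕ.^ k)) ℤ.* + (3 ℕ.^ (3 ℕ.* l)))   ≡⟨ trans (ι-homo-* (U ℤ.+ + (3 ℕ.^ k)) (+ (3 ℕ.^ (3 ℕ.* l)))) (cong₂ ℚ._*_ (ι-homo-+ U (+ (3 ℕ.^ k))) (pow3[3l]≡pow3[l]³ l)) ⟩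
    (ι U ℚ.+ c) ℚ.* (C ℚ.* C ℚ.* C)                   ≡⟨ cong (λ u → (u ℚ.+ c) ℚ.* (C ℚ.* C ℚ.* C)) c*a≡U ⟨
    (c ℚ.* a ℚ.+ c) ℚ.* (C ℚ.* C ℚ.* C)               ≡⟨ solve 3 (λ c a C → (c :* a :+ c) :* (C :* C :* C) := c :* (a :+ con 1ℚ) :* (C :* C :* C)) refl c a C ⟩
    c ℚ.* (a ℚ.+ 1ℚ) ℚ.* (C ℚ.* C ℚ.* C)              ≡⟨ cong (λ t → c ℚ.* t ℚ.* (C ℚ.* C ℚ.* C)) a+1≡g³ ⟩
    c ℚ.* (g ℚ.* g ℚ.* g) ℚ.* (C ℚ.* C ℚ.* C)         ≡⟨ solve 3 (λ c g C → c :* (g :* g :* g) :* (C :* C :* C) := (C :* g) :* (C :* g) :* (C :* g) :* c) refl c g C ⟩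
    (C ℚ.* g) ℚ.* (C ℚ.* g) ℚ.* (C ℚ.* g) ℚ.* c       ≡⟨ cong (λ t → t ℚ.* t ℚ.* t ℚ.* c) C*g≡G ⟩
    ι G ℚ.* ι G ℚ.* ι G ℚ.* c                         ≡⟨ sym (trans (ι-homo-* (G ℤ.* G ℤ.* G) (+ (3 ℕ.^ k))) (cong (ℚ._* c) (trans (ι-homo-* (G ℤ.* G) G) (cong (ℚ._* ι G) (ι-homo-* G G))))) ⟩
    ι (G ℤ.* G ℤ.* G ℤ.* + (3 ℕ.^ k))                 ∎)
    where
    open ≡-Reasoning
    c : ℚ
    c = pow3 k
    C : ℚ
    C = pow3 l

  ±3^e+1≡g³⇒ : ∀ {a g} →
    (Σ ℕ λ k → Σ ℕ λ i → Σ ℤ λ U → pow3 k ℚ.* a ≡ ι U × (U ≡ + (3 ℕ.^ i) ⊎ U ≡ ℤ.- + (3 ℕ.^ i))) →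
    (Σ ℕ λ l → IsInteger (pow3 l ℚ.* g)) → a ℚ.+ 1ℚ ≡ g ℚ.* g ℚ.* g →
    a ≡ ι -[1+ 0 ] × g ≡ 0ℚ ⊎ a ≡ ι -[1+ 8 ] × g ≡ ι -[1+ 1 ]
  ±3^e+1≡g³⇒ {a} {g} (k , i , U , c*a≡U , U≡±3^i) (l , G , C*g≡G) a+1≡g³ =
    values (±3^i+3^k-cube i k l U G U≡±3^i (cleared-equation k l U G c*a≡U C*g≡G a+1≡g³))
    where
    values : U ≡ ℤ.- + (3 ℕ.^ k) × G ≡ + 0 ⊎ U ≡ ℤ.- + (3 ℕ.^ (k ℕ.+ 2)) × G ≡ ℤ.- + (3 ℕ.^ l ℕ.* 2) →
             a ≡ ι -[1+ 0 ] × g ≡ 0ℚ ⊎ a ≡ ι -[1+ 8 ] × g ≡ ι -[1+ 1 ]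
    values (inj₁ (U≡-3^k , G≡0)) = inj₁ (a≡-1 , g≡0)
      where
      a≡-1 : a ≡ ι -[1+ 0 ]
      a≡-1 = pow3-cancel k -[1+ 0 ] (trans c*a≡U (cong ι (trans U≡-3^k
               (trans (cong (λ n → ℤ.- + n) (sym (ℕ.*-identityʳ (3 ℕ.^ k)))) (-[3^k*n]≡3^k*-n k 1)))))
      g≡0 : g ≡ 0ℚ
      g≡0 = pow3-cancel l (+ 0) (trans C*g≡G (cong ι (trans G≡0 (sym (ℤ.*-zeroʳ (+ (3 ℕ.^ l)))))))
    values (inj₂ (U≡-3^[k+2] , G≡-2*3^l)) = inj₂ (a≡-9 , g≡-2)
      where
      a≡-9 : a ≡ ι -[1+ 8 ]
      a≡-9 = pow3-cancel k -[1+ 8 ] (trans c*a≡U (cong ι (trans U≡-3^[k+2]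
               (trans (cong (λ n → ℤ.- + n) (ℕ.^-distribˡ-+-* 3 k 2)) (-[3^k*n]≡3^k*-n k 9)))))
      g≡-2 : g ≡ ι -[1+ 1 ]
      g≡-2 = pow3-cancel l -[1+ 1 ] (trans C*g≡G (cong ι (trans G≡-2*3^l (-[3^k*n]≡3^k*-n l 2))))

module SUnitEquation (d : ℕ) where
  open import Data.Nat.Base as ℕ using (_≤_; _%_)
  import Data.Nat.Properties as ℕ
  open import Data.Nat.Divisibility using (_∣_)
  open import Data.Integer.Base as ℤ using (ℤ; +_; -[1+_])
  import Data.Integer.Properties as ℤ
  open import Data.Rational.Base as ℚ using (ℚ; 0ℚ; 1ℚ; ↥_; ↧_)
  import Data.Rational.Properties as ℚ
  open import Data.List.Base using (_∷_; [])
  open import Data.Product.Base using (Σ; _×_; _,_; proj₁; proj₂)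
  open import Data.Sum.Base using (_⊎_; inj₁; inj₂)
  open import Data.Empty using (⊥-elim)
  open import Relation.Nullary using (¬_; yes; no)
  open import Relation.Binary.PropositionalEquality
  open import Data.Rational.Solver using (module +-*-Solver)
  open +-*-Solver

  open Rationals
  open QuadraticField d
  open Integrality
  open SquareFreeness
  open IntegerEquations
  open PowersOfThree

  rational-S-integer⇒integer : ∀ {x} → im x ≡ 0ℚ → InOS d x → Σ ℕ λ k → IsInteger (pow3 k ℚ.* re x)
  rational-S-integer⇒integer {x} im≡0 (k , 3^kx-integral) =
    k , subst IsInteger (cong re (ιℚ-⊗ (pow3 k) x)) (rational-integral⇒integer d (ιℚ (pow3 k) ⊗ x) im[3^kx]≡0 3^kx-integral)
    where
    im[3^kx]≡0 : im (ιℚ (pow3 k) ⊗ x) ≡ 0ℚ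
    im[3^kx]≡0 = trans (cong im (ιℚ-⊗ (pow3 k) x)) (trans (cong (pow3 k ℚ.*_) im≡0) (ℚ.*-zeroʳ (pow3 k)))

  -- 4n − t² = d (2 im x)², so square-freeness makes 2 im x an integer B with t² + dB² = 4n.
  trace-norm-integers⇒rational : 2 ≤ d → SquareFree d → d % 3 ≡ 1 → ∀ x t n n′ K →
    trace x ≡ ι t → norm x ≡ ι n → n ℤ.* n′ ≡ + (3 ℕ.^ K) → im x ≡ 0ℚ
  trace-norm-integers⇒rational 2≤d squarefree d%3≡1 x t n n′ K tr≡t nm≡n nn′≡3^K =
    *≡0⇒≡0 b 2≢0 (trans (solve 1 (λ b → con (ι (+ 2)) :* b := b :+ b) refl b) (trans B≡zB (cong ι zB≡0)))
    where
    open ≡-Reasoning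
    a : ℚ
    a = re x
    b : ℚ
    b = im x
    B : ℚ
    B = b ℚ.+ b
    2≢0 : ι (+ 2) ≢ 0ℚ
    2≢0 ()
    D*B²≡4n-t² : D ℚ.* (B ℚ.* B) ≡ ι (+ 4 ℤ.* n ℤ.- t ℤ.* t)
    D*B²≡4n-t² = begin
      D ℚ.* (B ℚ.* B)                                  ≡⟨ solve 3 (λ a b D → D :* ((b :+ b) :* (b :+ b))
                                                            := con (ι (+ 4)) :* (a :* a :+ D :* (b :* b)) :- (a :+ a) :* (a :+ a)) refl a b D ⟩
      ι (+ 4) ℚ.* norm x ℚ.- trace x ℚ.* trace x       ≡⟨ cong₂ (λ u v → ι (+ 4) ℚ.* u ℚ.- v ℚ.* v) nm≡n tr≡t ⟩
      ι (+ 4) ℚ.* ι n ℚ.- ι t ℚ.* ι t                  ≡⟨ cong₂ ℚ._-_ (ι-homo-* (+ 4) n) (ι-homo-* t t) ⟨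
      ι (+ 4 ℤ.* n) ℚ.- ι (t ℤ.* t)                    ≡⟨ ι-homo-- (+ 4 ℤ.* n) (t ℤ.* t) ⟨
      ι (+ 4 ℤ.* n ℤ.- t ℤ.* t)                        ∎
    zB : ℤ
    zB = proj₁ (squarefree⇒integer squarefree B (+ 4 ℤ.* n ℤ.- t ℤ.* t) D*B²≡4n-t²)
    B≡zB : B ≡ ι zB
    B≡zB = proj₂ (squarefree⇒integer squarefree B (+ 4 ℤ.* n ℤ.- t ℤ.* t) D*B²≡4n-t²)
    t²+dzB²≡4n : t ℤ.* t ℤ.+ + d ℤ.* (zB ℤ.* zB) ≡ + 4 ℤ.* n
    t²+dzB²≡4n = ι-injective (begin
      ι (t ℤ.* t ℤ.+ + d ℤ.* (zB ℤ.* zB))         ≡⟨ trans (ι-homo-+ (t ℤ.* t) (+ d ℤ.* (zB ℤ.* zB)))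
                                                       (cong₂ ℚ._+_ (ι-homo-* t t) (trans (ι-homo-* (+ d) (zB ℤ.* zB)) (cong (D ℚ.*_) (ι-homo-* zB zB)))) ⟩
      ι t ℚ.* ι t ℚ.+ D ℚ.* (ι zB ℚ.* ι zB)       ≡⟨ cong₂ (λ u v → u ℚ.* u ℚ.+ D ℚ.* (v ℚ.* v)) tr≡t B≡zB ⟨
      trace x ℚ.* trace x ℚ.+ D ℚ.* (B ℚ.* B)     ≡⟨ solve 3 (λ a b D → (a :+ a) :* (a :+ a) :+ D :* ((b :+ b) :* (b :+ b))
                                                       := con (ι (+ 4)) :* (a :* a :+ D :* (b :* b))) refl a b D ⟩
      ι (+ 4) ℚ.* norm x                          ≡⟨ cong (ι (+ 4) ℚ.*_) nm≡n ⟩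
      ι (+ 4) ℚ.* ι n                             ≡⟨ ι-homo-* (+ 4) n ⟨
      ι (+ 4 ℤ.* n)                               ∎)
    4∤d : ¬ 2 ℕ.* 2 ∣ d
    4∤d 4∣d with squarefree 2 4∣d
    ... | ()
    zB≡0 : zB ≡ + 0
    zB≡0 = a²+db²≡4n∧n∣3^k⇒b≡0 d%3≡1 2≤d 4∤d t zB n n′ K t²+dzB²≡4n nn′≡3^K

  norm-3^k*α*norm-3^m*β : ∀ {α β} k m → α ⊗ β ≡ 1K →
    norm (ιℚ (pow3 k) ⊗ α) ℚ.* norm (ιℚ (pow3 m) ⊗ β) ≡ pow3 (k ℕ.+ k ℕ.+ (m ℕ.+ m))
  norm-3^k*α*norm-3^m*β {α} {β} k m α⊗β≡1 = begin
    norm (ιℚ c ⊗ α) ℚ.* norm (ιℚ c′ ⊗ β)             ≡⟨ cong₂ ℚ._*_ (norm-scale c α) (norm-scale c′ β) ⟩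
    c ℚ.* c ℚ.* norm α ℚ.* (c′ ℚ.* c′ ℚ.* norm β)    ≡⟨ solve 4 (λ c c′ N N′ → c :* c :* N :* (c′ :* c′ :* N′) := c :* c :* (c′ :* c′) :* (N :* N′)) refl c c′ (norm α) (norm β) ⟩
    c ℚ.* c ℚ.* (c′ ℚ.* c′) ℚ.* (norm α ℚ.* norm β)  ≡⟨ cong (c ℚ.* c ℚ.* (c′ ℚ.* c′) ℚ.*_) (trans (sym (norm-homo-* α β)) (trans (cong norm α⊗β≡1) norm-1)) ⟩
    c ℚ.* c ℚ.* (c′ ℚ.* c′) ℚ.* 1ℚ                  ≡⟨ ℚ.*-identityʳ (c ℚ.* c ℚ.* (c′ ℚ.* c′)) ⟩
    c ℚ.* c ℚ.* (c′ ℚ.* c′)                         ≡⟨ cong₂ ℚ._*_ (pow3-+ k k) (pow3-+ m m) ⟨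
    pow3 (k ℕ.+ k) ℚ.* pow3 (m ℕ.+ m)               ≡⟨ pow3-+ (k ℕ.+ k) (m ℕ.+ m) ⟨
    pow3 (k ℕ.+ k ℕ.+ (m ℕ.+ m))                    ∎
    where
    open ≡-Reasoning
    c : ℚ
    c = pow3 k
    c′ : ℚ
    c′ = pow3 m

  S-unit⇒rational : 2 ≤ d → SquareFree d → d % 3 ≡ 1 → ∀ {α} → IsSUnit d α → im α ≡ 0ℚ
  S-unit⇒rational 2≤d squarefree d%3≡1 {α} ((k , cα-integral) , β , (m , c′β-integral) , α⊗β≡1) =
    *≡0⇒≡0 (im α) (pow3≢0 k) (trans (sym (cong im (ιℚ-⊗ (pow3 k) α)))
      (im≡0 (integral⇒integer-trace-norm d cα cα-integral) (proj₂ (integral⇒integer-trace-norm d c′β c′β-integral))))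
    where
    cα : K
    cα = ιℚ (pow3 k) ⊗ α
    c′β : K
    c′β = ιℚ (pow3 m) ⊗ β
    im≡0 : IsInteger (trace cα) × IsInteger (norm cα) → IsInteger (norm c′β) → im cα ≡ 0ℚ
    im≡0 ((t , tr≡t) , (n , nm≡n)) (n′ , nm′≡n′) =
      trace-norm-integers⇒rational 2≤d squarefree d%3≡1 cα t n n′ (k ℕ.+ k ℕ.+ (m ℕ.+ m)) tr≡t nm≡n (ι-injective (begin
        ι (n ℤ.* n′)                    ≡⟨ ι-homo-* n n′ ⟩
        ι n ℚ.* ι n′                    ≡⟨ cong₂ ℚ._*_ nm≡n nm′≡n′ ⟨
        norm cα ℚ.* norm c′β            ≡⟨ norm-3^k*α*norm-3^m*β k m α⊗β≡1 ⟩
        pow3 (k ℕ.+ k ℕ.+ (m ℕ.+ m))    ∎))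
      where open ≡-Reasoning

  rational-S-unit⇒±3^i : ∀ {α} → im α ≡ 0ℚ → IsSUnit d α →
    Σ ℕ λ k → Σ ℕ λ i → Σ ℤ λ U → pow3 k ℚ.* re α ≡ ι U × (U ≡ + (3 ℕ.^ i) ⊎ U ≡ ℤ.- + (3 ℕ.^ i))
  rational-S-unit⇒±3^i {α} im≡0 (α-S-integer , β , β-S-integer , α⊗β≡1) =
    ±3^i (rational-S-integer⇒integer im≡0 α-S-integer) (rational-S-integer⇒integer imβ≡0 β-S-integer)
    where
    open ≡-Reasoning
    a : ℚ
    a = re α
    a*β≡1 : (a ℚ.* re β) +√-d· (a ℚ.* im β) ≡ 1K
    a*β≡1 = trans (sym (ιℚ-⊗ a β)) (trans (cong (_⊗ β) (K-ext {ιℚ a} {α} refl (sym im≡0))) α⊗β≡1)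
    a≢0 : a ≢ 0ℚ
    a≢0 a≡0 = 1≢0 (trans (sym (cong re a*β≡1)) (trans (cong (ℚ._* re β) a≡0) (ℚ.*-zeroˡ (re β))))
      where
      1≢0 : 1ℚ ≢ 0ℚ
      1≢0 ()
    imβ≡0 : im β ≡ 0ℚ
    imβ≡0 = *≡0⇒≡0 (im β) a≢0 (cong im a*β≡1)
    ±3^i : Σ ℕ (λ k → IsInteger (pow3 k ℚ.* a)) → Σ ℕ (λ m → IsInteger (pow3 m ℚ.* re β)) →
           Σ ℕ λ k → Σ ℕ λ i → Σ ℤ λ U → pow3 k ℚ.* a ≡ ι U × (U ≡ + (3 ℕ.^ i) ⊎ U ≡ ℤ.- + (3 ℕ.^ i))
    ±3^i (k , U , c*a≡U) (m , W , c′*b≡W) = k , proj₁ U≡±3^i , U , c*a≡U , proj₂ U≡±3^i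
      where
      UW≡3^[k+m] : U ℤ.* W ≡ + (3 ℕ.^ (k ℕ.+ m))
      UW≡3^[k+m] = ι-injective (begin
        ι (U ℤ.* W)                             ≡⟨ ι-homo-* U W ⟩
        ι U ℚ.* ι W                             ≡⟨ cong₂ ℚ._*_ c*a≡U c′*b≡W ⟨
        pow3 k ℚ.* a ℚ.* (pow3 m ℚ.* re β)      ≡⟨ solve 4 (λ c a c′ b → c :* a :* (c′ :* b) := c :* c′ :* (a :* b)) refl (pow3 k) a (pow3 m) (re β) ⟩
        pow3 k ℚ.* pow3 m ℚ.* (a ℚ.* re β)      ≡⟨ cong (pow3 k ℚ.* pow3 m ℚ.*_) (cong re a*β≡1) ⟩
        pow3 k ℚ.* pow3 m ℚ.* 1ℚ                ≡⟨ ℚ.*-identityʳ (pow3 k ℚ.* pow3 m) ⟩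
        pow3 k ℚ.* pow3 m                       ≡⟨ pow3-+ k m ⟨
        pow3 (k ℕ.+ m)                          ∎)
      U≡±3^i : Σ ℕ λ i → U ≡ + (3 ℕ.^ i) ⊎ U ≡ ℤ.- + (3 ℕ.^ i)
      U≡±3^i = i*j≡3^k⇒i≡±3^f U W (k ℕ.+ m) UW≡3^[k+m]

  im-cube : ∀ g₀ g₁ → im (powK d (g₀ +√-d· g₁) 3) ≡ g₁ ℚ.* (ι (+ 3) ℚ.* (g₀ ℚ.* g₀) ℚ.- D ℚ.* (g₁ ℚ.* g₁))
  im-cube g₀ g₁ = solve 3 (λ g₀ g₁ D → proj₂ (mulᴾ D (g₀ , g₁) (mulᴾ D (g₀ , g₁) (mulᴾ D (g₀ , g₁) (con 1ℚ , con 0ℚ))))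
                     := g₁ :* (con (ι (+ 3)) :* (g₀ :* g₀) :- D :* (g₁ :* g₁))) refl g₀ g₁ D

  re-cube : ∀ g₀ → re (powK d (ιℚ g₀) 3) ≡ g₀ ℚ.* g₀ ℚ.* g₀
  re-cube g₀ = solve 2 (λ g₀ D → proj₁ (mulᴾ D (g₀ , con 0ℚ) (mulᴾ D (g₀ , con 0ℚ) (mulᴾ D (g₀ , con 0ℚ) (con 1ℚ , con 0ℚ))))
                  := g₀ :* g₀ :* g₀) refl g₀ D

  im-cube≡0⇒im≡0 : d % 3 ≡ 1 → ∀ γ → im (powK d γ 3) ≡ 0ℚ → im γ ≡ 0ℚ
  im-cube≡0⇒im≡0 d%3≡1 (g₀ +√-d· g₁) im≡0 with g₁ ℚ.≟ 0ℚ
  ... | yes g₁≡0 = g₁≡0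
  ... | no g₁≢0 = ⊥-elim (g₁≢0 (ℚ.↥p≡0⇒p≡0 g₁ ↥g₁≡0))
    where
    open ≡-Reasoning
    3g₀²≡Dg₁² : ι (+ 3) ℚ.* (g₀ ℚ.* g₀) ≡ D ℚ.* (g₁ ℚ.* g₁)
    3g₀²≡Dg₁² = begin
      ι (+ 3) ℚ.* (g₀ ℚ.* g₀)                                       ≡⟨ solve 2 (λ S T → S := (S :- T) :+ T) refl (ι (+ 3) ℚ.* (g₀ ℚ.* g₀)) (D ℚ.* (g₁ ℚ.* g₁)) ⟩
      ι (+ 3) ℚ.* (g₀ ℚ.* g₀) ℚ.- D ℚ.* (g₁ ℚ.* g₁) ℚ.+ D ℚ.* (g₁ ℚ.* g₁) ≡⟨ cong (ℚ._+ D ℚ.* (g₁ ℚ.* g₁)) (*≡0⇒≡0 _ g₁≢0 (trans (sym (im-cube g₀ g₁)) im≡0)) ⟩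
      0ℚ ℚ.+ D ℚ.* (g₁ ℚ.* g₁)                                      ≡⟨ ℚ.+-identityˡ _ ⟩
      D ℚ.* (g₁ ℚ.* g₁)                                             ∎
    u₀ : ℚ
    u₀ = ι (↧ g₀)
    u₁ : ℚ
    u₁ = ι (↧ g₁)
    X : ℤ
    X = ↥ g₀ ℤ.* ↧ g₁
    Y : ℤ
    Y = ↥ g₁ ℤ.* ↧ g₀
    3X²≡dY² : + 3 ℤ.* (X ℤ.* X) ≡ + d ℤ.* (Y ℤ.* Y)
    3X²≡dY² = ι-injective (begin
      ι (+ 3 ℤ.* (X ℤ.* X))                           ≡⟨ trans (ι-homo-* (+ 3) (X ℤ.* X)) (cong (ι (+ 3) ℚ.*_) (trans (ι-homo-* X X) (cong₂ ℚ._*_ (ι-homo-* (↥ g₀) (↧ g₁)) (ι-homo-* (↥ g₀) (↧ g₁))))) ⟩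
      ι (+ 3) ℚ.* ((ι (↥ g₀) ℚ.* u₁) ℚ.* (ι (↥ g₀) ℚ.* u₁)) ≡⟨ cong (λ z → ι (+ 3) ℚ.* ((z ℚ.* u₁) ℚ.* (z ℚ.* u₁))) (ι↧*p≡ι↥ g₀) ⟨
      ι (+ 3) ℚ.* ((u₀ ℚ.* g₀ ℚ.* u₁) ℚ.* (u₀ ℚ.* g₀ ℚ.* u₁)) ≡⟨ solve 4 (λ t u₀ u₁ g → t :* ((u₀ :* g :* u₁) :* (u₀ :* g :* u₁)) := (u₀ :* u₁ :* (u₀ :* u₁)) :* (t :* (g :* g))) refl (ι (+ 3)) u₀ u₁ g₀ ⟩
      (u₀ ℚ.* u₁ ℚ.* (u₀ ℚ.* u₁)) ℚ.* (ι (+ 3) ℚ.* (g₀ ℚ.* g₀)) ≡⟨ cong ((u₀ ℚ.* u₁ ℚ.* (u₀ ℚ.* u₁)) ℚ.*_) 3g₀²≡Dg₁² ⟩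
      (u₀ ℚ.* u₁ ℚ.* (u₀ ℚ.* u₁)) ℚ.* (D ℚ.* (g₁ ℚ.* g₁)) ≡⟨ solve 4 (λ u₀ u₁ g D → (u₀ :* u₁ :* (u₀ :* u₁)) :* (D :* (g :* g)) := D :* ((u₁ :* g :* u₀) :* (u₁ :* g :* u₀))) refl u₀ u₁ g₁ D ⟩
      D ℚ.* ((u₁ ℚ.* g₁ ℚ.* u₀) ℚ.* (u₁ ℚ.* g₁ ℚ.* u₀))   ≡⟨ cong (λ z → D ℚ.* ((z ℚ.* u₀) ℚ.* (z ℚ.* u₀))) (ι↧*p≡ι↥ g₁) ⟩
      D ℚ.* ((ι (↥ g₁) ℚ.* u₀) ℚ.* (ι (↥ g₁) ℚ.* u₀))     ≡⟨ sym (trans (ι-homo-* (+ d) (Y ℤ.* Y)) (cong (D ℚ.*_) (trans (ι-homo-* Y Y) (cong₂ ℚ._*_ (ι-homo-* (↥ g₁) (↧ g₀)) (ι-homo-* (↥ g₁) (↧ g₀)))))) ⟩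
      ι (+ d ℤ.* (Y ℤ.* Y))                               ∎)
    ↥g₁≡0 : ↥ g₁ ≡ + 0
    ↥g₁≡0 = ℤ.∣i∣≡0⇒i≡0 (ℕ.m*n≡0⇒m≡0 ℤ.∣ ↥ g₁ ∣ (ℚ.↧ₙ g₀) (trans (sym (ℤ.abs-* (↥ g₁) (↧ g₀))) (cong ℤ.∣_∣ (3a²≡db²⇒b≡0ℤ {d} d%3≡1 X Y 3X²≡dY²))))

  Solution : K → K → Set
  Solution α γ = (α ≡ ιℤ -[1+ 0 ] × γ ≡ 0K) ⊎ (α ≡ ιℤ -[1+ 8 ] × γ ≡ ιℤ -[1+ 1 ])

  only-solutions : 2 ≤ d → SquareFree d → d % 3 ≡ 1 → ∀ α γ →
    IsSUnit d α × InOS d γ × addK α 1K ≡ powK d γ 3 → Solution α γ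
  only-solutions 2≤d squarefree d%3≡1 α@(a +√-d· b) γ@(g₀ +√-d· g₁) (α-S-unit , γ-S-integer , α+1≡γ³) =
    in-K (±3^e+1≡g³⇒ (rational-S-unit⇒±3^i b≡0 α-S-unit) (rational-S-integer⇒integer g₁≡0 γ-S-integer) a+1≡g₀³)
    where
    b≡0 : b ≡ 0ℚ
    b≡0 = S-unit⇒rational 2≤d squarefree d%3≡1 α-S-unit
    g₁≡0 : g₁ ≡ 0ℚ
    g₁≡0 = im-cube≡0⇒im≡0 d%3≡1 γ (trans (sym (cong im α+1≡γ³)) (trans (ℚ.+-identityʳ b) b≡0))
    a+1≡g₀³ : a ℚ.+ 1ℚ ≡ g₀ ℚ.* g₀ ℚ.* g₀
    a+1≡g₀³ = trans (cong re α+1≡γ³) (trans (cong (λ g → re (powK d (g₀ +√-d· g) 3)) g₁≡0) (re-cube g₀))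
    in-K : a ≡ ι -[1+ 0 ] × g₀ ≡ 0ℚ ⊎ a ≡ ι -[1+ 8 ] × g₀ ≡ ι -[1+ 1 ] → Solution α γ
    in-K (inj₁ (a≡-1 , g₀≡0)) = inj₁ (K-ext {α} {ιℤ -[1+ 0 ]} a≡-1 b≡0 , K-ext {γ} {0K} g₀≡0 g₁≡0)
    in-K (inj₂ (a≡-9 , g₀≡-2)) = inj₂ (K-ext {α} {ιℤ -[1+ 8 ]} a≡-9 b≡0 , K-ext {γ} {ιℤ -[1+ 1 ]} g₀≡-2 g₁≡0)

  integer-integral : ∀ z → IsIntegral d (ιℤ z)
  integer-integral z = ℤ.- z ∷ [] , (begin
    ιℤ (ℤ.- z) ⊕ ιℤ z ⊗ 1K     ≡⟨ cong (ιℤ (ℤ.- z) ⊕_) (trans (ιℚ-homo-* (ι z) 1ℚ) (cong ιℚ (ℚ.*-identityʳ (ι z)))) ⟩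
    ιℤ (ℤ.- z) ⊕ ιℤ z          ≡⟨ K-ext {ιℤ (ℤ.- z) ⊕ ιℤ z} {0K} (trans (cong (ℚ._+ ι z) (ι-homo-neg z)) (ℚ.+-inverseˡ (ι z))) refl ⟩
    0K                         ∎)
    where open ≡-Reasoning

  integral⇒S-integer : ∀ {x} → IsIntegral d x → InOS d x
  integral⇒S-integer {x} x-integral = 0 , subst (IsIntegral d) (sym (⊗-identityˡ x)) x-integral

  ιℚ-cube : ∀ q → powK d (ιℚ q) 3 ≡ ιℚ (q ℚ.* (q ℚ.* (q ℚ.* 1ℚ)))
  ιℚ-cube q = trans (cong (λ w → ιℚ q ⊗ (ιℚ q ⊗ w)) (ιℚ-homo-* q 1ℚ))
    (trans (cong (ιℚ q ⊗_) (ιℚ-homo-* q (q ℚ.* 1ℚ))) (ιℚ-homo-* q (q ℚ.* (q ℚ.* 1ℚ))))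

  solution⇒S-unit-equation : ∀ α γ → Solution α γ → IsSUnit d α × InOS d γ × addK α 1K ≡ powK d γ 3
  solution⇒S-unit-equation α γ (inj₁ (refl , refl)) =
    (-1-S-integer , ιℤ -[1+ 0 ] , -1-S-integer , ιℚ-homo-* (ι -[1+ 0 ]) (ι -[1+ 0 ])) ,
    integral⇒S-integer (integer-integral (+ 0)) ,
    sym (⊗-zeroˡ (0K ⊗ (0K ⊗ 1K)))
    where
    -1-S-integer : InOS d (ιℤ -[1+ 0 ])
    -1-S-integer = integral⇒S-integer (integer-integral -[1+ 0 ])
  solution⇒S-unit-equation α γ (inj₂ (refl , refl)) =
    (integral⇒S-integer (integer-integral -[1+ 8 ]) , ιℚ -1/9 , -1/9-S-integer , ιℚ-homo-* (ι -[1+ 8 ]) -1/9) ,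
    integral⇒S-integer (integer-integral -[1+ 1 ]) ,
    sym (ιℚ-cube (ι -[1+ 1 ]))
    where
    -1/9 : ℚ
    -1/9 = -[1+ 0 ] ℚ./ 9
    -1/9-S-integer : InOS d (ιℚ -1/9)
    -1/9-S-integer = 2 , subst (IsIntegral d) (sym (ιℚ-homo-* (ι (+ 9)) -1/9)) (integer-integral -[1+ 0 ])

proposition4p1 : (d : ℕ) → 2 ≤ d → SquareFree d → d % 3 ≡ 1 →
    (α γ : K) →
      (IsSUnit d α × InOS d γ × addK α 1K ≡ powK d γ 3)
      ⇔ ((α ≡ ιℤ -[1+ 0 ] × γ ≡ 0K) ⊎ (α ≡ ιℤ -[1+ 8 ] × γ ≡ ιℤ -[1+ 1 ]))
proposition4p1 d 2≤d squarefree d%3≡1 α γ =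
  mk⇔ (SUnitEquation.only-solutions d 2≤d squarefree d%3≡1 α γ) (SUnitEquation.solution⇒S-unit-equation d α γ)
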